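{- For any integer $k\ge 6$, with $h=\lfloor\frac{k-2}{2}\rfloor$, the number of $k$-caps in $\mathbb{Z}_2^n$ of dimension $k-2$ is \[ Q_{k-2}(k,n)=Q_{k-2}(k-1,n)\cdot\sum_{i=2}^{h}\frac{1}{2i+2}\binom{k-1}{2i+1} =Q_{k-2}(k-1,n)\left[\frac16\binom{k-1}{5}+\frac18\binom{k-1}{7}+\cdots+\frac{1}{2h+2}\binom{k-1}{2h+1}\right]. \]
   Context: $\mathbb{Z}_2^n$ is the $n$-dimensional vector space over $\mathbb{Z}_2$. A quad is a set of four distinct elements $a,b,c,d$ with $a+b+c+d=\vec 0$; a cap is a subset containing no quad; a $k$-cap is a cap with $k$ elements. Over $\mathbb{Z}_2$, affine combinations are sums of an odd number of elements and $\mathrm{aff}(S)$ is the set of affine combinations of elements of $S$. The dimension of a cap $C$ is the dimension of the flat $\mathrm{aff}(C)$. $Q_r(k,n)$ denotes the number of $k$-caps in $\mathbb{Z}_2^n$ of dimension $r$; in particular $Q_{k-2}(k-1,n)$ is the number of $(k-1)$-caps of dimension $k-2$, i.e. of affinely independent $(k-1)$-element subsets. -}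

module Defs where

open import Data.Bool using (Bool; true; false; _xor_)
import Data.Bool.Properties as BoolP
open import Data.Nat using (ℕ; zero; suc; _+_; _*_; _∸_; _^_; _%_)
import Data.Nat.Properties as ℕP
open import Data.Nat.Combinatorics using (_C_)
open import Data.Vec using (Vec; []; _∷_; zipWith; replicate)
import Data.Vec.Properties as VecP
open import Data.List using (List; []; _∷_; [_]; map; _++_; length; filter; foldr; upTo)
open import Data.List.Relation.Unary.All using (All)
import Data.List.Relation.Unary.Any
import Data.Nat
open import Data.List.Relation.Unary.All using () renaming (all? to All-all?)
open import Data.Product using (_×_)
open import Relation.Nullary using (¬_; Dec)
open import Relation.Nullary.Decidable using (_×-dec_; ¬?)
open import Relation.Binary.PropositionalEquality using (_≡_; _≢_)
open import Data.Integer using (+_)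
open import Data.Rational using (ℚ; _/_) renaming (_+_ to _+ℚ_; _*_ to _*ℚ_; 0ℚ to 0ℚ)

V : ℕ → Set
V n = Vec Bool n

_⊕_ : ∀ {n} → V n → V n → V n
_⊕_ = zipWith _xor_

𝟎 : ∀ n → V n
𝟎 n = replicate n false

_≟V_ : ∀ {n} (u v : V n) → Dec (u ≡ v)
_≟V_ = VecP.≡-dec BoolP._≟_

sumV : ∀ n → List (V n) → V n
sumV n = foldr _⊕_ (𝟎 n)

allVecs : ∀ n → List (V n)
allVecs zero = [ [] ]
allVecs (suc n) = map (false ∷_) (allVecs n) ++ map (true ∷_) (allVecs n)

-- all k-element sublists (k-combinations) of a list; on a duplicate-free list
-- these enumerate each k-subset exactly once
combs : ∀ {A : Set} → ℕ → List A → List (List A)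
combs zero _ = [ [] ]
combs (suc k) [] = []
combs (suc k) (x ∷ xs) = map (x ∷_) (combs k xs) ++ combs (suc k) xs

sublists : ∀ {A : Set} → List A → List (List A)
sublists [] = [ [] ]
sublists (x ∷ xs) = map (x ∷_) (sublists xs) ++ sublists xs

IsCap : ∀ n → List (V n) → Set
IsCap n S = All (λ q → sumV n q ≢ 𝟎 n) (combs 4 S)

isCap? : ∀ n (S : List (V n)) → Dec (IsCap n S)
isCap? n S = All-all? (λ q → ¬? (sumV n q ≟V 𝟎 n)) (combs 4 S)

-- affine combinations: sums of an odd number of (distinct) elements of S
Odd : ℕ → Set
Odd m = m % 2 ≡ 1

affCombs : ∀ n → List (V n) → List (V n)
affCombs n S = map (sumV n) (filter (λ T → length T % 2 Data.Nat.≟ 1) (sublists S))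

InAff : ∀ n → List (V n) → V n → Set
InAff n S v = Data.List.Relation.Unary.Any.Any (v ≡_) (affCombs n S)

inAff? : ∀ n S v → Dec (InAff n S v)
inAff? n S v = Data.List.Relation.Unary.Any.any? (v ≟V_) (affCombs n S)

affCard : ∀ n → List (V n) → ℕ
affCard n S = length (filter (inAff? n S) (allVecs n))

-- S has dimension r : the flat aff(S) has dimension r, i.e. 2^r elements
HasDim : ∀ n → ℕ → List (V n) → Set
HasDim n r S = affCard n S ≡ 2 ^ r

Q : ℕ → ℕ → ℕ → ℕ
Q r k n = length (filter (λ S → isCap? n S ×-dec (affCard n S Data.Nat.≟ 2 ^ r))
                         (combs k (allVecs n)))

sumℚ : List ℚ → ℚ
sumℚ = foldr _+ℚ_ 0ℚ

range2 : ℕ → List ℕ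
range2 h = map (λ j → 2 + j) (upTo (h ∸ 1))

term : ℕ → ℕ → ℚ
term k i = (+ ((k ∸ 1) C (1 + 2 * i))) / (2 + 2 * i)

hOf : ℕ → ℕ
hOf k = (k ∸ 2) Data.Nat./ 2

fromℕℚ : ℕ → ℚ
fromℕℚ m = (+ m) / 1

{-# OPTIONS --safe #-}

-- A k-subset S of Z₂ⁿ has dimension k − 2 exactly when it carries a unique nontrivial affine
-- dependency: a unique nonempty subset δ ⊆ S of even size summing to 0.  As the points are
-- distinct |δ| ≠ 2, and S is a cap iff |δ| ≠ 4, so these caps split according to |δ| = 2i + 2
-- with 2 ≤ i ≤ h.  Count the pairs (S, z) with z ∈ δ in two ways.  Removing z leaves an affinely
-- independent (k − 1)-set T of which z is the sum of 2i + 1 elements; conversely each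
-- independent T and each (2i + 1)-subset of T give such a pair, the sums being distinct (and
-- outside T) because T is independent.  Hence
--   (2i + 2) · #{S : |δ| = 2i + 2} = Q_{k−2}(k − 1, n) · C(k − 1, 2i + 1).
-- Dimensions are read off from |aff(s ∷ S)| · 2^nullity = 2^|S|, where the nullity counts the
-- points lying in the affine hull of the points after them.

module Submission where

open import Defs
open import Data.Nat using (ℕ; _≤_)
open import Data.List using (map)
open import Data.Rational using (ℚ) renaming (_*_ to _*ℚ_)
open import Relation.Binary.PropositionalEquality using (_≡_)

open import Data.Bool as Bool using (Bool; true; false; not; _xor_)
open import Data.Bool.Properties
  using ( not-injective; not-involutive; not-distribˡ-xor; not-distribʳ-xor; xor-annihilates-not
        ; xor-comm; xor-assoc; xor-identityˡ; xor-identityʳ; xor-same )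
open import Data.Empty using (⊥-elim)
open import Data.List using (List; []; _∷_; _++_; length; filter; [_])
open import Data.List.Membership.Propositional using (_∈_)
open import Data.List.Membership.Propositional.Properties
  using (∈-map⁺; ∈-map⁻; ∈-++⁺ˡ; ∈-++⁺ʳ; ∈-++⁻; ∈-filter⁺; ∈-filter⁻; ∈-upTo⁺)
open import Data.List.Properties using (map-++; map-∘; map-cong-local)
open import Data.List.Relation.Unary.All as All using (All; []; _∷_)
open import Data.List.Relation.Unary.Any using (here; there)
open import Data.List.Relation.Unary.AllPairs using ([]; _∷_)
open import Data.List.Relation.Unary.Unique.Propositional using (Unique)
open import Data.List.Relation.Unary.Unique.Propositional.Properties using (map⁺; ++⁺; upTo⁺)
open import Data.List.Relation.Binary.Disjoint.Propositional using (Disjoint)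
open import Data.Nat as ℕ using (zero; suc; _+_; _*_; _∸_; _^_; _/_; z≤n; s≤s)
import Data.Nat.Properties as ℕP
open import Data.Nat.DivMod using ([m+n]%n≡m%n; m*n/n≡m; /-monoˡ-≤)
open import Algebra.Properties.CommutativeSemigroup ℕP.+-commutativeSemigroup
  using (interchange; xy∙z≈y∙xz)
open import Algebra.Properties.CommutativeSemigroup ℕP.*-commutativeSemigroup
  using () renaming (x∙yz≈y∙xz to *-leftComm)
open import Data.Nat.ListAction using (sum)
open import Data.Nat.ListAction.Properties using (sum-++)
open import Data.Nat.Combinatorics using (_C_; nCk+nC[k+1]≡[n+1]C[k+1])
open import Data.Product using (Σ; Σ-syntax; ∃; _×_; _,_; proj₁; proj₂)
open import Data.Sum using (_⊎_; inj₁; inj₂; [_,_]′)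
open import Data.Vec using ([]; _∷_)
open import Data.Vec.Properties
  using (∷-injectiveʳ; zipWith-comm; zipWith-assoc; zipWith-identityˡ; zipWith-identityʳ)
open import Function using (case_of_; _∘_; _⇔_; mk⇔; Equivalence)
open Equivalence using (to; from)
open import Relation.Nullary using (¬_; Dec; yes; no)
open import Relation.Nullary.Decidable using (_×-dec_; _⊎-dec_)
open import Relation.Unary using (Decidable)
open import Relation.Binary using (DecidableEquality)
open import Relation.Binary.PropositionalEquality
  using (refl; sym; trans; cong; cong₂; subst; subst₂; _≢_; module ≡-Reasoning)

private
  variable
    A B : Set

∑ : List A → (A → ℕ) → ℕ
∑ xs f = sum (map f xs)

syntax ∑ xs (λ x → e) = ∑[ x ∈ xs ] e

∑-cong : (xs : List A) {f g : A → ℕ} → (∀ {x} → x ∈ xs → f x ≡ g x) → ∑ xs f ≡ ∑ xs g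
∑-cong xs f≗g = cong sum (map-cong-local (All.tabulate f≗g))

∑-++ : (xs ys : List A) (f : A → ℕ) → ∑ (xs ++ ys) f ≡ ∑ xs f + ∑ ys f
∑-++ xs ys f = trans (cong sum (map-++ f xs ys)) (sum-++ (map f xs) (map f ys))

∑-map : (g : A → B) (xs : List A) (f : B → ℕ) → ∑ (map g xs) f ≡ ∑ xs (f ∘ g)
∑-map g xs f = cong sum (sym (map-∘ xs))

∑-+ : (xs : List A) (f g : A → ℕ) → ∑[ x ∈ xs ] (f x + g x) ≡ ∑ xs f + ∑ xs g
∑-+ []       f g = refl
∑-+ (x ∷ xs) f g = trans (cong (f x + g x +_) (∑-+ xs f g)) (interchange (f x) (g x) _ _)

∑-zero : (xs : List A) {f : A → ℕ} → (∀ {x} → x ∈ xs → f x ≡ 0) → ∑ xs f ≡ 0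
∑-zero []       f≡0 = refl
∑-zero (x ∷ xs) f≡0 = cong₂ _+_ (f≡0 (here refl)) (∑-zero xs (f≡0 ∘ there))

∑-*ʳ : (c : ℕ) (xs : List A) (f : A → ℕ) → ∑[ x ∈ xs ] (f x * c) ≡ ∑ xs f * c
∑-*ʳ c []       f = refl
∑-*ʳ c (x ∷ xs) f = trans (cong (f x * c +_) (∑-*ʳ c xs f)) (sym (ℕP.*-distribʳ-+ c (f x) _))

∑-comm : (xs : List A) (ys : List B) (f : A → B → ℕ) →
         ∑[ x ∈ xs ] ∑[ y ∈ ys ] f x y ≡ ∑[ y ∈ ys ] ∑[ x ∈ xs ] f x y
∑-comm []       ys f = sym (∑-zero ys (λ _ → refl))
∑-comm (x ∷ xs) ys f =
  trans (cong (∑ ys (f x) +_) (∑-comm xs ys f)) (sym (∑-+ ys (f x) (λ y → ∑[ x′ ∈ xs ] f x′ y)))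

𝟙 : {P : Set} → Dec P → ℕ
𝟙 (yes _) = 1
𝟙 (no _)  = 0

𝟙-yes : {P : Set} (p? : Dec P) → P → 𝟙 p? ≡ 1
𝟙-yes (yes _) _ = refl
𝟙-yes (no ¬p) p = ⊥-elim (¬p p)

𝟙-no : {P : Set} (p? : Dec P) → ¬ P → 𝟙 p? ≡ 0
𝟙-no (yes p) ¬p = ⊥-elim (¬p p)
𝟙-no (no _)  _  = refl

𝟙-cong : {P Q : Set} (p? : Dec P) (q? : Dec Q) → P ⇔ Q → 𝟙 p? ≡ 𝟙 q?
𝟙-cong (yes _) (yes _) _   = refl
𝟙-cong (yes p) (no ¬q) P⇔Q = ⊥-elim (¬q (to P⇔Q p))
𝟙-cong (no ¬p) (yes q) P⇔Q = ⊥-elim (¬p (from P⇔Q q))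
𝟙-cong (no _)  (no _)  _   = refl

𝟙-⊎ : {P Q : Set} (p? : Dec P) (q? : Dec Q) → ¬ (P × Q) → 𝟙 (p? ⊎-dec q?) ≡ 𝟙 p? + 𝟙 q?
𝟙-⊎ (yes p) (yes q) ¬pq = ⊥-elim (¬pq (p , q))
𝟙-⊎ (yes _) (no _)  _   = refl
𝟙-⊎ (no _)  (yes _) _   = refl
𝟙-⊎ (no _)  (no _)  _   = refl

count : {P : A → Set} → Decidable P → List A → ℕ
count P? xs = ∑[ x ∈ xs ] 𝟙 (P? x)

module _ {P : A → Set} (P? : Decidable P) where

  length-filter≡count : (xs : List A) → length (filter P? xs) ≡ count P? xs
  length-filter≡count []       = refl
  length-filter≡count (x ∷ xs) with P? x
  ... | yes _ = cong suc (length-filter≡count xs)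
  ... | no _  = length-filter≡count xs

  count-cong : {Q : A → Set} (Q? : Decidable Q) → (∀ x → P x ⇔ Q x) → (xs : List A) →
               count P? xs ≡ count Q? xs
  count-cong Q? P⇔Q xs = ∑-cong xs (λ {x} _ → 𝟙-cong (P? x) (Q? x) (P⇔Q x))

  count-⊎ : {Q : A → Set} (Q? : Decidable Q) → (∀ x → ¬ (P x × Q x)) → (xs : List A) →
            count (λ x → P? x ⊎-dec Q? x) xs ≡ count P? xs + count Q? xs
  count-⊎ Q? disjoint xs =
    trans (∑-cong xs (λ {x} _ → 𝟙-⊎ (P? x) (Q? x) (disjoint x))) (∑-+ xs (𝟙 ∘ P?) (𝟙 ∘ Q?))

  count-none : (xs : List A) → (∀ {x} → x ∈ xs → ¬ P x) → count P? xs ≡ 0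
  count-none xs ¬P = ∑-zero xs (λ {x} x∈xs → 𝟙-no (P? x) (¬P x∈xs))

count-≡ : (_≟_ : DecidableEquality A) {xs : List A} {x : A} → Unique xs → x ∈ xs → count (_≟ x) xs ≡ 1
count-≡ _≟_ {y ∷ ys} (y∉ys ∷ _) (here refl) =
  cong₂ _+_ (𝟙-yes (y ≟ y) refl)
            (count-none (_≟ y) ys (λ y′∈ys y′≡y → All.lookup y∉ys y′∈ys (sym y′≡y)))
count-≡ _≟_ {y ∷ ys} (y∉ys ∷ uniq) (there x∈ys) =
  cong₂ _+_ (𝟙-no (y ≟ _) (All.lookup y∉ys x∈ys)) (count-≡ _≟_ uniq x∈ys)

parity : ℕ → Bool
parity zero    = false
parity (suc m) = not (parity m)

parity-+ : ∀ a b → parity (a + b) ≡ parity a xor parity b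
parity-+ zero    b = refl
parity-+ (suc a) b = trans (cong not (parity-+ a b)) (not-distribˡ-xor (parity a) (parity b))

parity-even : ∀ i → parity (2 * i) ≡ false
parity-even i = trans (cong (parity ∘ (i +_)) (ℕP.+-identityʳ i)) (trans (parity-+ i i) (xor-same (parity i)))

parity-odd : ∀ {w} i → w ≡ 1 + 2 * i → parity w ≡ true
parity-odd i refl = cong not (parity-even i)

parity≡false⇒even : ∀ w → parity w ≡ false → ∃ λ j → w ≡ 2 * j
parity≡false⇒even zero          _ = 0 , refl
parity≡false⇒even (suc (suc w)) p with parity≡false⇒even w (trans (sym (not-involutive (parity w))) p)
... | j , refl = suc j , cong suc (sym (ℕP.+-suc j (j + 0)))

%2≡1⇔parity≡true : ∀ m → (m ℕ.% 2 ≡ 1) ⇔ (parity m ≡ true)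
%2≡1⇔parity≡true zero          = mk⇔ (λ ()) (λ ())
%2≡1⇔parity≡true (suc zero)    = mk⇔ (λ _ → refl) (λ _ → refl)
%2≡1⇔parity≡true (suc (suc m)) = mk⇔
  (λ odd → trans (not-involutive (parity m)) (to (%2≡1⇔parity≡true m) (trans (sym [2+m]%2≡m%2) odd)))
  (λ par → trans [2+m]%2≡m%2 (from (%2≡1⇔parity≡true m) (trans (sym (not-involutive (parity m))) par)))
  where
  [2+m]%2≡m%2 : (2 + m) ℕ.% 2 ≡ m ℕ.% 2
  [2+m]%2≡m%2 = trans (cong (ℕ._% 2) (ℕP.+-comm 2 m)) ([m+n]%n≡m%n m 2)

2^-injective : ∀ a b → 2 ^ a ≡ 2 ^ b → a ≡ b
2^-injective zero    zero    _ = refl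
2^-injective zero    (suc b) e with () ← trans (cong parity e) (parity-even (2 ^ b))
2^-injective (suc a) zero    e with () ← trans (cong parity (sym e)) (parity-even (2 ^ a))
2^-injective (suc a) (suc b) e = cong suc (2^-injective a b (ℕP.*-cancelˡ-≡ (2 ^ a) (2 ^ b) 2 e))

2+2*-injective : ∀ {i j} → 2 + 2 * i ≡ 2 + 2 * j → i ≡ j
2+2*-injective {i} {j} e = ℕP.*-cancelˡ-≡ i j 2 (ℕP.+-cancelˡ-≡ 2 (2 * i) (2 * j) e)

2*m≤n⇒m≤n/2 : ∀ {m n} → 2 * m ≤ n → m ≤ n / 2
2*m≤n⇒m≤n/2 {m} {n} le =
  subst (_≤ n / 2) (trans (cong (_/ 2) (ℕP.*-comm 2 m)) (m*n/n≡m m 2)) (/-monoˡ-≤ 2 le)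

module _ {n : ℕ} where

  ⊕-comm : (u v : V n) → u ⊕ v ≡ v ⊕ u
  ⊕-comm = zipWith-comm xor-comm

  ⊕-assoc : (u v w : V n) → (u ⊕ v) ⊕ w ≡ u ⊕ (v ⊕ w)
  ⊕-assoc = zipWith-assoc xor-assoc

  ⊕-identityˡ : (u : V n) → 𝟎 n ⊕ u ≡ u
  ⊕-identityˡ = zipWith-identityˡ xor-identityˡ

  ⊕-identityʳ : (u : V n) → u ⊕ 𝟎 n ≡ u
  ⊕-identityʳ = zipWith-identityʳ xor-identityʳ

⊕-self : ∀ {n} (u : V n) → u ⊕ u ≡ 𝟎 n
⊕-self []      = refl
⊕-self (a ∷ u) = cong₂ _∷_ (xor-same a) (⊕-self u)

module _ {n : ℕ} where

  ⊕-cancelˡ : (u v : V n) → u ⊕ (u ⊕ v) ≡ v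
  ⊕-cancelˡ u v = trans (sym (⊕-assoc u u v)) (trans (cong (_⊕ v) (⊕-self u)) (⊕-identityˡ v))

  ⊕-leftComm : (u v w : V n) → u ⊕ (v ⊕ w) ≡ v ⊕ (u ⊕ w)
  ⊕-leftComm u v w = trans (sym (⊕-assoc u v w)) (trans (cong (_⊕ w) (⊕-comm u v)) (⊕-assoc v u w))

  ⊕-transposeˡ : {u v w : V n} → u ⊕ v ≡ w → v ≡ u ⊕ w
  ⊕-transposeˡ {u} {v} refl = sym (⊕-cancelˡ u v)

  ⊕≡𝟎⇒≡ : {u v : V n} → u ⊕ v ≡ 𝟎 n → u ≡ v
  ⊕≡𝟎⇒≡ {u} {v} u⊕v≡𝟎 = trans (sym (⊕-identityʳ u)) (sym (⊕-transposeˡ u⊕v≡𝟎))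

∑-allVecs-suc : ∀ {n} (f : V (suc n) → ℕ) →
  ∑ (allVecs (suc n)) f ≡ ∑[ v ∈ allVecs n ] f (false ∷ v) + ∑[ v ∈ allVecs n ] f (true ∷ v)
∑-allVecs-suc {n} f = trans (∑-++ (map (false ∷_) (allVecs n)) (map (true ∷_) (allVecs n)) f)
                             (cong₂ _+_ (∑-map _ (allVecs n) f) (∑-map _ (allVecs n) f))

∑-allVecs-translate : ∀ n (t : V n) (f : V n → ℕ) → ∑[ v ∈ allVecs n ] f (t ⊕ v) ≡ ∑ (allVecs n) f
∑-allVecs-translate zero    []          f = refl
∑-allVecs-translate (suc n) (false ∷ t) f = begin
  ∑[ v ∈ allVecs (suc n) ] f ((false ∷ t) ⊕ v)
    ≡⟨ ∑-allVecs-suc (f ∘ ((false ∷ t) ⊕_)) ⟩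
  ∑[ v ∈ allVecs n ] f (false ∷ t ⊕ v) + ∑[ v ∈ allVecs n ] f (true ∷ t ⊕ v)
    ≡⟨ cong₂ _+_ (∑-allVecs-translate n t (f ∘ (false ∷_)))
                 (∑-allVecs-translate n t (f ∘ (true ∷_))) ⟩
  ∑[ v ∈ allVecs n ] f (false ∷ v) + ∑[ v ∈ allVecs n ] f (true ∷ v)
    ≡⟨ ∑-allVecs-suc f ⟨
  ∑ (allVecs (suc n)) f ∎
  where open ≡-Reasoning
∑-allVecs-translate (suc n) (true ∷ t) f = begin
  ∑[ v ∈ allVecs (suc n) ] f ((true ∷ t) ⊕ v)
    ≡⟨ ∑-allVecs-suc (f ∘ ((true ∷ t) ⊕_)) ⟩
  ∑[ v ∈ allVecs n ] f (true ∷ t ⊕ v) + ∑[ v ∈ allVecs n ] f (false ∷ t ⊕ v)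
    ≡⟨ cong₂ _+_ (∑-allVecs-translate n t (f ∘ (true ∷_)))
                 (∑-allVecs-translate n t (f ∘ (false ∷_))) ⟩
  ∑[ v ∈ allVecs n ] f (true ∷ v) + ∑[ v ∈ allVecs n ] f (false ∷ v)
    ≡⟨ trans (ℕP.+-comm (∑[ v ∈ allVecs n ] f (true ∷ v)) _) (sym (∑-allVecs-suc f)) ⟩
  ∑ (allVecs (suc n)) f ∎
  where open ≡-Reasoning

∈-allVecs : ∀ {n} (v : V n) → v ∈ allVecs n
∈-allVecs []          = here refl
∈-allVecs (false ∷ v) = ∈-++⁺ˡ (∈-map⁺ (false ∷_) (∈-allVecs v))
∈-allVecs (true ∷ v)  = ∈-++⁺ʳ _ (∈-map⁺ (true ∷_) (∈-allVecs v))

allVecs-unique : ∀ n → Unique (allVecs n)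
allVecs-unique zero    = [] ∷ []
allVecs-unique (suc n) =
  ++⁺ (map⁺ ∷-injectiveʳ (allVecs-unique n)) (map⁺ ∷-injectiveʳ (allVecs-unique n)) disjoint
  where
  disjoint : Disjoint (map (false ∷_) (allVecs n)) (map (true ∷_) (allVecs n))
  disjoint (p , q) with ∈-map⁻ (false ∷_) p | ∈-map⁻ (true ∷_) q
  ... | _ , _ , refl | _ , _ , ()

count-allVecs-≡ : ∀ n (x : V n) → count (_≟V x) (allVecs n) ≡ 1
count-allVecs-≡ n x = count-≡ _≟V_ (allVecs-unique n) (∈-allVecs x)

count-fibre : ∀ {n} {P : Set} (p? : Dec P) (x : V n) →
              count (λ y → p? ×-dec (x ≟V y)) (allVecs n) ≡ 𝟙 p?
count-fibre {n} (yes p) x =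
  trans (count-cong (λ y → yes p ×-dec (x ≟V y)) (_≟V x)
                    (λ y → mk⇔ (sym ∘ proj₂) (λ y≡x → p , sym y≡x)) (allVecs n))
        (count-allVecs-≡ n x)
count-fibre {n} (no ¬p) x = count-none (λ y → no ¬p ×-dec (x ≟V y)) (allVecs n) (λ _ → ¬p ∘ proj₁)

data Mask {A : Set} : List A → Set where
  []ₘ  : Mask []
  _∷ₘ_ : ∀ {x xs} → Bool → Mask xs → Mask (x ∷ xs)

infixr 5 _∷ₘ_

select : {S : List A} → Mask S → List A
select []ₘ                      = []
select {S = x ∷ _} (true ∷ₘ m)  = x ∷ select m
select             (false ∷ₘ m) = select m

weight : {S : List A} → Mask S → ℕ
weight m = length (select m)

Σsel : ∀ {n} {S : List (V n)} → Mask S → V n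
Σsel {n} m = sumV n (select m)

∷ₘ-injectiveʳ : {x : A} {S : List A} {b c : Bool} {m m′ : Mask S} →
                _≡_ {A = Mask (x ∷ S)} (b ∷ₘ m) (c ∷ₘ m′) → m ≡ m′
∷ₘ-injectiveʳ refl = refl

∅ₘ : (S : List A) → Mask S
∅ₘ []      = []ₘ
∅ₘ (x ∷ S) = false ∷ₘ ∅ₘ S

_⊕ₘ_ : {S : List A} → Mask S → Mask S → Mask S
[]ₘ      ⊕ₘ []ₘ       = []ₘ
(a ∷ₘ m) ⊕ₘ (b ∷ₘ m′) = (a xor b) ∷ₘ (m ⊕ₘ m′)

masks : (S : List A) → List (Mask S)
masks []      = [ []ₘ ]
masks (x ∷ S) = map (false ∷ₘ_) (masks S) ++ map (true ∷ₘ_) (masks S)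

∃-mask? : (S : List A) {P : Mask S → Set} → Decidable P → Dec (Σ (Mask S) P)
∃-mask? [] P? with P? []ₘ
... | yes p = yes ([]ₘ , p)
... | no ¬p = no λ { ([]ₘ , p) → ¬p p }
∃-mask? (x ∷ S) P? with ∃-mask? S (P? ∘ (false ∷ₘ_)) | ∃-mask? S (P? ∘ (true ∷ₘ_))
... | yes (m , p) | _           = yes (false ∷ₘ m , p)
... | no _        | yes (m , p) = yes (true ∷ₘ m , p)
... | no ¬p       | no ¬q       = no λ { (false ∷ₘ m , p) → ¬p (m , p)
                                       ; (true ∷ₘ m , q)  → ¬q (m , q) }

select-∅ₘ : (S : List A) → select (∅ₘ S) ≡ []
select-∅ₘ []      = refl
select-∅ₘ (x ∷ S) = select-∅ₘ S

weight-∅ₘ : (S : List A) → weight (∅ₘ S) ≡ 0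
weight-∅ₘ S = cong length (select-∅ₘ S)

Σsel-∅ₘ : ∀ {n} (S : List (V n)) → Σsel (∅ₘ S) ≡ 𝟎 n
Σsel-∅ₘ {n} S = cong (sumV n) (select-∅ₘ S)

weight≡0⇒∅ₘ : {S : List A} (m : Mask S) → weight m ≡ 0 → m ≡ ∅ₘ S
weight≡0⇒∅ₘ []ₘ          _ = refl
weight≡0⇒∅ₘ (false ∷ₘ m) w = cong (false ∷ₘ_) (weight≡0⇒∅ₘ m w)

weight-⊕ₘ≡0⇒≡ : {S : List A} (m m′ : Mask S) → weight (m ⊕ₘ m′) ≡ 0 → m ≡ m′
weight-⊕ₘ≡0⇒≡ []ₘ          []ₘ           _ = refl
weight-⊕ₘ≡0⇒≡ (true ∷ₘ m)  (true ∷ₘ m′)  w = cong (true ∷ₘ_)  (weight-⊕ₘ≡0⇒≡ m m′ w)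
weight-⊕ₘ≡0⇒≡ (false ∷ₘ m) (false ∷ₘ m′) w = cong (false ∷ₘ_) (weight-⊕ₘ≡0⇒≡ m m′ w)

parity-weight-⊕ₘ : {S : List A} (m m′ : Mask S) →
  parity (weight (m ⊕ₘ m′)) ≡ parity (weight m) xor parity (weight m′)
parity-weight-⊕ₘ []ₘ          []ₘ           = refl
parity-weight-⊕ₘ (true ∷ₘ m)  (true ∷ₘ m′)  =
  trans (parity-weight-⊕ₘ m m′) (sym (xor-annihilates-not (parity (weight m)) _))
parity-weight-⊕ₘ (true ∷ₘ m)  (false ∷ₘ m′) =
  trans (cong not (parity-weight-⊕ₘ m m′)) (not-distribˡ-xor (parity (weight m)) _)
parity-weight-⊕ₘ (false ∷ₘ m) (true ∷ₘ m′)  =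
  trans (cong not (parity-weight-⊕ₘ m m′)) (not-distribʳ-xor (parity (weight m)) _)
parity-weight-⊕ₘ (false ∷ₘ m) (false ∷ₘ m′) = parity-weight-⊕ₘ m m′

Σsel-⊕ₘ : ∀ {n} {S : List (V n)} (m m′ : Mask S) → Σsel (m ⊕ₘ m′) ≡ Σsel m ⊕ Σsel m′
Σsel-⊕ₘ {n}         []ₘ          []ₘ           = sym (⊕-self (𝟎 n))
Σsel-⊕ₘ {S = x ∷ _} (true ∷ₘ m)  (true ∷ₘ m′)  = begin
  Σsel (m ⊕ₘ m′)                ≡⟨ Σsel-⊕ₘ m m′ ⟩
  Σsel m ⊕ Σsel m′              ≡⟨ ⊕-cancelˡ x _ ⟨
  x ⊕ (x ⊕ (Σsel m ⊕ Σsel m′))  ≡⟨ cong (x ⊕_) (⊕-leftComm (Σsel m) x (Σsel m′)) ⟨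
  x ⊕ (Σsel m ⊕ (x ⊕ Σsel m′))  ≡⟨ ⊕-assoc x (Σsel m) (x ⊕ Σsel m′) ⟨
  (x ⊕ Σsel m) ⊕ (x ⊕ Σsel m′)  ∎
  where open ≡-Reasoning
Σsel-⊕ₘ {S = x ∷ _} (true ∷ₘ m)  (false ∷ₘ m′) =
  trans (cong (x ⊕_) (Σsel-⊕ₘ m m′)) (sym (⊕-assoc x _ _))
Σsel-⊕ₘ {S = x ∷ _} (false ∷ₘ m) (true ∷ₘ m′)  =
  trans (cong (x ⊕_) (Σsel-⊕ₘ m m′)) (⊕-leftComm x _ _)
Σsel-⊕ₘ             (false ∷ₘ m) (false ∷ₘ m′) = Σsel-⊕ₘ m m′

weight≤length : {S : List A} (m : Mask S) → weight m ≤ length S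
weight≤length []ₘ          = z≤n
weight≤length (true ∷ₘ m)  = s≤s (weight≤length m)
weight≤length (false ∷ₘ m) = ℕP.m≤n⇒m≤1+n (weight≤length m)

select∈sublists : {S : List A} (m : Mask S) → select m ∈ sublists S
select∈sublists {S = []}    []ₘ          = here refl
select∈sublists {S = x ∷ S} (true ∷ₘ m)  = ∈-++⁺ˡ (∈-map⁺ (x ∷_) (select∈sublists m))
select∈sublists {S = x ∷ S} (false ∷ₘ m) = ∈-++⁺ʳ (map (x ∷_) (sublists S)) (select∈sublists m)

∈sublists⇒select : {S T : List A} → T ∈ sublists S → ∃ λ (m : Mask S) → T ≡ select m
∈sublists⇒select {S = []}    (here refl) = []ₘ , refl
∈sublists⇒select {S = x ∷ S} T∈ with ∈-++⁻ (map (x ∷_) (sublists S)) T∈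
... | inj₁ T∈₁ with ∈-map⁻ (x ∷_) T∈₁
...   | _ , T′∈ , refl with ∈sublists⇒select T′∈
...     | m , T′≡ = true ∷ₘ m , cong (x ∷_) T′≡
∈sublists⇒select {S = x ∷ S} T∈ | inj₂ T∈₂ with ∈sublists⇒select T∈₂
... | m , T≡ = false ∷ₘ m , T≡

select∈combs : ∀ k {S : List A} (m : Mask S) → weight m ≡ k → select m ∈ combs k S
select∈combs zero    {S}     m            w = here (trans (cong select (weight≡0⇒∅ₘ m w)) (select-∅ₘ S))
select∈combs (suc k) {x ∷ S} (true ∷ₘ m)  w =
  ∈-++⁺ˡ (∈-map⁺ (x ∷_) (select∈combs k m (ℕP.suc-injective w)))
select∈combs (suc k) {x ∷ S} (false ∷ₘ m) w =
  ∈-++⁺ʳ (map (x ∷_) (combs k S)) (select∈combs (suc k) m w)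

∈combs⇒select : ∀ k {S T : List A} → T ∈ combs k S →
                ∃ λ (m : Mask S) → weight m ≡ k × T ≡ select m
∈combs⇒select zero    {S}     (here refl) = ∅ₘ S , weight-∅ₘ S , sym (select-∅ₘ S)
∈combs⇒select (suc k) {x ∷ S} T∈ with ∈-++⁻ (map (x ∷_) (combs k S)) T∈
... | inj₁ T∈₁ with ∈-map⁻ (x ∷_) T∈₁
...   | _ , T′∈ , refl with ∈combs⇒select k T′∈
...     | m , w , T′≡ = true ∷ₘ m , cong suc w , cong (x ∷_) T′≡
∈combs⇒select (suc k) {x ∷ S} T∈ | inj₂ T∈₂ with ∈combs⇒select (suc k) T∈₂
... | m , w , T≡ = false ∷ₘ m , w , T≡

combs-length : ∀ k (S : List A) {T : List A} → T ∈ combs k S → length T ≡ k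
combs-length k S T∈ with ∈combs⇒select k T∈
... | m , w , refl = w

All-select : {P : A → Set} {S : List A} (m : Mask S) → All P S → All P (select m)
All-select []ₘ          []         = []
All-select (true ∷ₘ m)  (px ∷ pxs) = px ∷ All-select m pxs
All-select (false ∷ₘ m) (_  ∷ pxs) = All-select m pxs

select-unique : {S : List A} (m : Mask S) → Unique S → Unique (select m)
select-unique []ₘ          []           = []
select-unique (true ∷ₘ m)  (x∉S ∷ uniq) = All-select m x∉S ∷ select-unique m uniq
select-unique (false ∷ₘ m) (_   ∷ uniq) = select-unique m uniq

combs-unique : ∀ k {S T : List A} → Unique S → T ∈ combs k S → Unique T
combs-unique k uniq T∈ with ∈combs⇒select k T∈
... | m , _ , refl = select-unique m uniq

∑-masks-∷ : (x : A) (S : List A) (f : Mask (x ∷ S) → ℕ) →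
  ∑ (masks (x ∷ S)) f ≡ ∑[ m ∈ masks S ] f (false ∷ₘ m) + ∑[ m ∈ masks S ] f (true ∷ₘ m)
∑-masks-∷ x S f = trans (∑-++ (map (false ∷ₘ_) (masks S)) (map (true ∷ₘ_) (masks S)) f)
                             (cong₂ _+_ (∑-map _ (masks S) f) (∑-map _ (masks S) f))

count-masks-weight : (S : List A) (w : ℕ) → count (λ m → weight m ℕ.≟ w) (masks S) ≡ length S C w
count-masks-weight []      zero    = refl
count-masks-weight []      (suc w) = refl
count-masks-weight (x ∷ S) zero    = begin
  count (λ m → weight m ℕ.≟ 0) (masks (x ∷ S))
    ≡⟨ ∑-masks-∷ x S (λ m → 𝟙 (weight m ℕ.≟ 0)) ⟩
  count (λ m → weight m ℕ.≟ 0) (masks S) + count (λ m → suc (weight m) ℕ.≟ 0) (masks S)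
    ≡⟨ cong₂ _+_ (count-masks-weight S 0)
                 (count-none (λ m → suc (weight m) ℕ.≟ 0) (masks S) (λ _ ())) ⟩
  1 ∎
  where open ≡-Reasoning
count-masks-weight (x ∷ S) (suc w) = begin
  count (λ m → weight m ℕ.≟ suc w) (masks (x ∷ S))
    ≡⟨ ∑-masks-∷ x S (λ m → 𝟙 (weight m ℕ.≟ suc w)) ⟩
  count (λ m → weight m ℕ.≟ suc w) (masks S) + count (λ m → suc (weight m) ℕ.≟ suc w) (masks S)
    ≡⟨ cong (count (λ m → weight m ℕ.≟ suc w) (masks S) +_)
            (count-cong (λ m → suc (weight m) ℕ.≟ suc w) (λ m → weight m ℕ.≟ w)
                        (λ m → mk⇔ ℕP.suc-injective (cong suc)) (masks S)) ⟩
  count (λ m → weight m ℕ.≟ suc w) (masks S) + count (λ m → weight m ℕ.≟ w) (masks S)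
    ≡⟨ cong₂ _+_ (count-masks-weight S (suc w)) (count-masks-weight S w) ⟩
  length S C suc w + length S C w
    ≡⟨ trans (ℕP.+-comm (length S C suc w) _) (nCk+nC[k+1]≡[n+1]C[k+1] (length S) w) ⟩
  suc (length S) C suc w ∎
  where open ≡-Reasoning

𝟙-∃-mask≡count : (S : List A) {P : Mask S → Set} (P? : Decidable P) →
  (∀ {m m′} → P m → P m′ → m ≡ m′) → 𝟙 (∃-mask? S P?) ≡ count P? (masks S)
𝟙-∃-mask≡count [] P? _ with P? []ₘ
... | yes _ = refl
... | no _  = refl
𝟙-∃-mask≡count (x ∷ S) P? unique
  with ∃-mask? S (P? ∘ (false ∷ₘ_))
     | 𝟙-∃-mask≡count S (P? ∘ (false ∷ₘ_)) (λ p q → ∷ₘ-injectiveʳ (unique p q))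
     | ∃-mask? S (P? ∘ (true ∷ₘ_))
     | 𝟙-∃-mask≡count S (P? ∘ (true ∷ₘ_)) (λ p q → ∷ₘ-injectiveʳ (unique p q))
... | yes (_ , p) | _  | yes (_ , q) | _  with () ← unique p q
... | yes _       | e₀ | no _        | e₁ = trans (cong₂ _+_ e₀ e₁) (sym (∑-masks-∷ x S (𝟙 ∘ P?)))
... | no _        | e₀ | yes _       | e₁ = trans (cong₂ _+_ e₀ e₁) (sym (∑-masks-∷ x S (𝟙 ∘ P?)))
... | no _        | e₀ | no _        | e₁ = trans (cong₂ _+_ e₀ e₁) (sym (∑-masks-∷ x S (𝟙 ∘ P?)))

data Pick {A : Set} (z : A) : List A → List A → Set where
  pick-head : ∀ {r} → Pick z r (z ∷ r)
  pick-tail : ∀ {x r S} → Pick z r S → Pick z (x ∷ r) (x ∷ S)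

module _ {z : A} where

  insert : {r S : List A} → Pick z r S → Bool → Mask r → Mask S
  insert pick-head     b m          = b ∷ₘ m
  insert (pick-tail p) b (c ∷ₘ m) = c ∷ₘ insert p b m

  at : {r S : List A} → Pick z r S → Mask S → Bool
  at pick-head     (b ∷ₘ _) = b
  at (pick-tail p) (_ ∷ₘ m) = at p m

  at-insert : {r S : List A} (p : Pick z r S) (b : Bool) (m : Mask r) → at p (insert p b m) ≡ b
  at-insert pick-head     b m        = refl
  at-insert (pick-tail p) b (_ ∷ₘ m) = at-insert p b m

  insert-view : {r S : List A} (p : Pick z r S) (d : Mask S) → ∃ λ m → d ≡ insert p (at p d) m
  insert-view pick-head     (b ∷ₘ m) = m , refl
  insert-view (pick-tail p) (c ∷ₘ d) with insert-view p d
  ... | m , d≡ = c ∷ₘ m , cong (c ∷ₘ_) d≡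

  weight-insert-true : {r S : List A} (p : Pick z r S) (m : Mask r) → weight (insert p true m) ≡ suc (weight m)
  weight-insert-true pick-head     m            = refl
  weight-insert-true (pick-tail p) (true ∷ₘ m)  = cong suc (weight-insert-true p m)
  weight-insert-true (pick-tail p) (false ∷ₘ m) = weight-insert-true p m

  weight-insert-false : {r S : List A} (p : Pick z r S) (m : Mask r) → weight (insert p false m) ≡ weight m
  weight-insert-false pick-head     m            = refl
  weight-insert-false (pick-tail p) (true ∷ₘ m)  = cong suc (weight-insert-false p m)
  weight-insert-false (pick-tail p) (false ∷ₘ m) = weight-insert-false p m

Σsel-insert-true : ∀ {n} {z : V n} {r S} (p : Pick z r S) (m : Mask r) →
                   Σsel (insert p true m) ≡ z ⊕ Σsel m
Σsel-insert-true                    pick-head     m            = refl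
Σsel-insert-true {z = z} {S = x ∷ _} (pick-tail p) (true ∷ₘ m)  =
  trans (cong (x ⊕_) (Σsel-insert-true p m)) (⊕-leftComm x z _)
Σsel-insert-true                    (pick-tail p) (false ∷ₘ m) = Σsel-insert-true p m

Σsel-insert-false : ∀ {n} {z : V n} {r S} (p : Pick z r S) (m : Mask r) →
                    Σsel (insert p false m) ≡ Σsel m
Σsel-insert-false            pick-head     m            = refl
Σsel-insert-false {S = x ∷ _} (pick-tail p) (true ∷ₘ m)  = cong (x ⊕_) (Σsel-insert-false p m)
Σsel-insert-false            (pick-tail p) (false ∷ₘ m) = Σsel-insert-false p m

Picked : List A → Set _
Picked {A} S = Σ A λ z → Σ (List A) λ r → Pick z r S

liftPicked : {x : A} {S : List A} → Picked S → Picked (x ∷ S)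
liftPicked (z , r , p) = z , _ , pick-tail p

picks : (S : List A) → List (Picked S)
picks []      = []
picks (x ∷ S) = (x , S , pick-head) ∷ map liftPicked (picks S)

∑-picks-∷ : (x : A) (S : List A) (f : Picked (x ∷ S) → ℕ) →
  ∑ (picks (x ∷ S)) f ≡ f (x , S , pick-head) + ∑[ q ∈ picks S ] f (liftPicked q)
∑-picks-∷ x S f = cong (f (x , S , pick-head) +_) (∑-map liftPicked (picks S) f)

∑-picks-at : {S : List A} (d : Mask S) → ∑[ (_ , _ , p) ∈ picks S ] 𝟙 (at p d Bool.≟ true) ≡ weight d
∑-picks-at []ₘ = refl
∑-picks-at {S = x ∷ S} (b ∷ₘ d) =
  trans (∑-picks-∷ x S (λ (_ , _ , p) → 𝟙 (at p (b ∷ₘ d) Bool.≟ true))) (head-term b (∑-picks-at d))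
  where
  head-term : ∀ b {k} → k ≡ weight d → 𝟙 (b Bool.≟ true) + k ≡ weight (_∷ₘ_ {x = x} b d)
  head-term true  refl = refl
  head-term false refl = refl

∑-combs-∷ : (k : ℕ) (x : A) (xs : List A) (f : List A → ℕ) →
  ∑ (combs (suc k) (x ∷ xs)) f ≡ ∑[ T ∈ combs k xs ] f (x ∷ T) + ∑ (combs (suc k) xs) f
∑-combs-∷ k x xs f = trans (∑-++ (map (x ∷_) (combs k xs)) (combs (suc k) xs) f)
                            (cong (_+ ∑ (combs (suc k) xs) f) (∑-map (x ∷_) (combs k xs) f))

picksSum : (List A → A → ℕ) → List A → ℕ
picksSum P S = ∑[ (z , r , _) ∈ picks S ] P r z

-- Pairs (S, z ∈ S) correspond to pairs (T, y ∉ T) via T = S − z; the terms with y ∈ T must vanish.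
∑-combs-picks : (X : List A) (k : ℕ) (P : List A → A → ℕ) → (∀ {T y} → y ∈ T → P T y ≡ 0) →
  ∑[ S ∈ combs (suc k) X ] picksSum P S ≡ ∑[ T ∈ combs k X ] ∑[ y ∈ X ] P T y
∑-combs-picks []       zero    P _ = refl
∑-combs-picks []       (suc k) P _ = refl
∑-combs-picks (x ∷ xs) zero    P vanish = begin
  ∑[ S ∈ combs 1 (x ∷ xs) ] picksSum P S
    ≡⟨ ∑-combs-∷ 0 x xs (picksSum P) ⟩
  (P [] x + 0) + 0 + ∑[ S ∈ combs 1 xs ] picksSum P S
    ≡⟨ cong₂ _+_ (trans (ℕP.+-identityʳ _) (ℕP.+-identityʳ _)) (∑-combs-picks xs 0 P vanish) ⟩
  P [] x + (∑[ y ∈ xs ] P [] y + 0)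
    ≡⟨ ℕP.+-assoc (P [] x) _ 0 ⟨
  ∑[ T ∈ combs 0 (x ∷ xs) ] ∑[ y ∈ x ∷ xs ] P T y ∎
  where open ≡-Reasoning
∑-combs-picks (x ∷ xs) (suc k) P vanish = begin
  ∑[ S ∈ combs (2 + k) (x ∷ xs) ] picksSum P S
    ≡⟨ ∑-combs-∷ (suc k) x xs (picksSum P) ⟩
  ∑[ T ∈ combs (suc k) xs ] picksSum P (x ∷ T) + ∑[ S ∈ combs (2 + k) xs ] picksSum P S
    ≡⟨ cong (_+ _) (∑-cong (combs (suc k) xs) (λ {T} _ → ∑-picks-∷ x T (λ (z , r , _) → P r z))) ⟩
  ∑[ T ∈ combs (suc k) xs ] (P T x + picksSum Pₓ T) + ∑[ S ∈ combs (2 + k) xs ] picksSum P S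
    ≡⟨ cong₂ _+_ (∑-+ (combs (suc k) xs) (λ T → P T x) (picksSum Pₓ))
                 (∑-combs-picks xs (suc k) P vanish) ⟩
  (a + ∑[ T ∈ combs (suc k) xs ] picksSum Pₓ T) + c
    ≡⟨ cong (λ b → (a + b) + c) (∑-combs-picks xs k Pₓ (vanish ∘ there)) ⟩
  (a + b) + c
    ≡⟨ xy∙z≈y∙xz a b c ⟩
  b + (a + c)
    ≡⟨ cong₂ _+_ (∑-cong (combs k xs) (λ {T} _ → cong (_+ ∑[ y ∈ xs ] Pₓ T y) (vanish (here refl))))
                 (∑-+ (combs (suc k) xs) (λ T → P T x) (λ T → ∑[ y ∈ xs ] P T y)) ⟨
  ∑[ T ∈ combs k xs ] ∑[ y ∈ x ∷ xs ] Pₓ T y + ∑[ T ∈ combs (suc k) xs ] ∑[ y ∈ x ∷ xs ] P T y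
    ≡⟨ ∑-combs-∷ k x xs (λ T → ∑[ y ∈ x ∷ xs ] P T y) ⟨
  ∑[ T ∈ combs (suc k) (x ∷ xs) ] ∑[ y ∈ x ∷ xs ] P T y ∎
  where
  open ≡-Reasoning
  Pₓ = λ T y → P (x ∷ T) y
  a = ∑[ T ∈ combs (suc k) xs ] P T x
  b = ∑[ T ∈ combs k xs ] ∑[ y ∈ xs ] Pₓ T y
  c = ∑[ T ∈ combs (suc k) xs ] ∑[ y ∈ xs ] P T y

-- Affine combinations and dimension

module _ {n : ℕ} where

  Represents : {S : List (V n)} → Mask S → Bool → V n → Set
  Represents m b v = parity (weight m) ≡ b × Σsel m ≡ v

  Comb : List (V n) → Bool → V n → Set
  Comb S b v = Σ (Mask S) λ m → Represents m b v

  comb? : (S : List (V n)) (b : Bool) (v : V n) → Dec (Comb S b v)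
  comb? S b v = ∃-mask? S (λ m → (parity (weight m) Bool.≟ b) ×-dec (Σsel m ≟V v))

  represents-⊕ₘ : {S : List (V n)} (m m′ : Mask S) {b c : Bool} {u w : V n} →
    Represents m b u → Represents m′ c w → Represents (m ⊕ₘ m′) (b xor c) (u ⊕ w)
  represents-⊕ₘ m m′ (refl , refl) (refl , refl) = parity-weight-⊕ₘ m m′ , Σsel-⊕ₘ m m′

  comb-⊕ : {S : List (V n)} {b c : Bool} {u w : V n} → Comb S b u → Comb S c w → Comb S (b xor c) (u ⊕ w)
  comb-⊕ (m , rep) (m′ , rep′) = m ⊕ₘ m′ , represents-⊕ₘ m m′ rep rep′

  comb-[] : {v : V n} → ¬ Comb [] true v
  comb-[] ([]ₘ , () , _)

  comb-∷⇔ : {x : V n} {S : List (V n)} {v : V n} →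
            Comb (x ∷ S) true v ⇔ (Comb S true v ⊎ Comb S false (x ⊕ v))
  comb-∷⇔ {x} {S} {v} = mk⇔ split join
    where
    split : Comb (x ∷ S) true v → Comb S true v ⊎ Comb S false (x ⊕ v)
    split (false ∷ₘ m , rep)        = inj₁ (m , rep)
    split (true ∷ₘ m , par , x⊕Σ≡v) = inj₂ (m , not-injective par , ⊕-transposeˡ x⊕Σ≡v)
    join : Comb S true v ⊎ Comb S false (x ⊕ v) → Comb (x ∷ S) true v
    join (inj₁ (m , rep))          = false ∷ₘ m , rep
    join (inj₂ (m , par , Σ≡x⊕v)) =
      true ∷ₘ m , cong not par , trans (cong (x ⊕_) Σ≡x⊕v) (⊕-cancelˡ x v)

  InAff⇔Comb : (S : List (V n)) (v : V n) → InAff n S v ⇔ Comb S true v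
  InAff⇔Comb S v = mk⇔ toComb fromComb
    where
    toComb : InAff n S v → Comb S true v
    toComb v∈ with ∈-map⁻ (sumV n) v∈
    ... | T , T∈ , refl with ∈-filter⁻ (λ T → length T ℕ.% 2 ℕ.≟ 1) {xs = sublists S} T∈
    ...   | T∈sub , odd with ∈sublists⇒select T∈sub
    ...     | m , T≡ = m , to (%2≡1⇔parity≡true (weight m)) (subst (λ U → length U ℕ.% 2 ≡ 1) T≡ odd)
                          , cong (sumV n) (sym T≡)
    fromComb : Comb S true v → InAff n S v
    fromComb (m , par , refl) =
      ∈-map⁺ (sumV n) (∈-filter⁺ (λ T → length T ℕ.% 2 ℕ.≟ 1) (select∈sublists m)
                                 (from (%2≡1⇔parity≡true (weight m)) par))

  affCard≡count-comb : (S : List (V n)) → affCard n S ≡ count (comb? S true) (allVecs n)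
  affCard≡count-comb S = trans (length-filter≡count (inAff? n S) (allVecs n))
                               (count-cong (inAff? n S) (comb? S true) (InAff⇔Comb S) (allVecs n))

  count-comb-translate : (S : List (V n)) (b : Bool) (t : V n) →
    count (λ v → comb? S b (t ⊕ v)) (allVecs n) ≡ count (comb? S b) (allVecs n)
  count-comb-translate S b t = ∑-allVecs-translate n t (𝟙 ∘ comb? S b)

  ∈⇒weight≡1 : {S : List (V n)} {y : V n} → y ∈ S → Σ[ m ∈ Mask S ] weight m ≡ 1 × Σsel m ≡ y
  ∈⇒weight≡1 {x ∷ S} (here refl) =
    true ∷ₘ ∅ₘ S , cong suc (weight-∅ₘ S) , trans (cong (x ⊕_) (Σsel-∅ₘ S)) (⊕-identityʳ x)
  ∈⇒weight≡1         (there y∈)  =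
    let (m , w≡1 , Σ≡y) = ∈⇒weight≡1 y∈ in false ∷ₘ m , w≡1 , Σ≡y

  comb-head : (s : V n) (S : List (V n)) → Comb (s ∷ S) true s
  comb-head s S = let (m , w≡1 , Σ≡s) = ∈⇒weight≡1 {s ∷ S} (here refl) in m , cong parity w≡1 , Σ≡s

  affCard-[x] : (x : V n) → affCard n [ x ] ≡ 1
  affCard-[x] x = begin
    affCard n [ x ]                         ≡⟨ affCard≡count-comb [ x ] ⟩
    count (comb? [ x ] true) (allVecs n)    ≡⟨ count-cong (comb? [ x ] true) (_≟V x) comb-[x]⇔ (allVecs n) ⟩
    count (_≟V x) (allVecs n)               ≡⟨ count-allVecs-≡ n x ⟩
    1                                       ∎
    where
    open ≡-Reasoning
    comb-[x]⇔ : ∀ v → Comb [ x ] true v ⇔ (v ≡ x)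
    comb-[x]⇔ v = mk⇔
      ([ ⊥-elim ∘ comb-[] , (λ { ([]ₘ , _ , 𝟎≡x⊕v) → sym (⊕≡𝟎⇒≡ (sym 𝟎≡x⊕v)) }) ]′
       ∘ to comb-∷⇔)
      (λ { refl → comb-head x [] })

  affCard-∷-∈aff : (x : V n) (S : List (V n)) → Comb S true x → affCard n (x ∷ S) ≡ affCard n S
  affCard-∷-∈aff x S cx = begin
    affCard n (x ∷ S)
      ≡⟨ affCard≡count-comb (x ∷ S) ⟩
    count (comb? (x ∷ S) true) (allVecs n)
      ≡⟨ count-cong (comb? (x ∷ S) true) (comb? S true) comb-∷x⇔ (allVecs n) ⟩
    count (comb? S true) (allVecs n)
      ≡⟨ affCard≡count-comb S ⟨
    affCard n S ∎
    where
    open ≡-Reasoning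
    comb-∷x⇔ : ∀ v → Comb (x ∷ S) true v ⇔ Comb S true v
    comb-∷x⇔ v = mk⇔
      ([ (λ c → c)
       , (λ c → subst (Comb S true) (trans (⊕-comm (x ⊕ v) x) (⊕-cancelˡ x v)) (comb-⊕ c cx)) ]′
       ∘ to comb-∷⇔)
      (from comb-∷⇔ ∘ inj₁)

  affCard-∷-∉aff : (x s : V n) (S : List (V n)) → ¬ Comb (s ∷ S) true x →
                   affCard n (x ∷ s ∷ S) ≡ affCard n (s ∷ S) + affCard n (s ∷ S)
  -- aff (x ∷ S′) is the disjoint union of aff S′ and x + (even sums from S′), and adding s ∈ S′
  -- exchanges even and odd sums.
  affCard-∷-∉aff x s S ∉aff = begin
    affCard n (x ∷ S′)
      ≡⟨ affCard≡count-comb (x ∷ S′) ⟩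
    count (comb? (x ∷ S′) true) (allVecs n)
      ≡⟨ count-cong (comb? (x ∷ S′) true) (λ v → comb? S′ true v ⊎-dec comb? S′ false (x ⊕ v))
                    (λ _ → comb-∷⇔) (allVecs n) ⟩
    count (λ v → comb? S′ true v ⊎-dec comb? S′ false (x ⊕ v)) (allVecs n)
      ≡⟨ count-⊎ (comb? S′ true) (λ v → comb? S′ false (x ⊕ v)) disjoint (allVecs n) ⟩
    count (comb? S′ true) (allVecs n) + count (λ v → comb? S′ false (x ⊕ v)) (allVecs n)
      ≡⟨ cong (count (comb? S′ true) (allVecs n) +_) odd≡even ⟩
    count (comb? S′ true) (allVecs n) + count (comb? S′ true) (allVecs n)
      ≡⟨ cong₂ _+_ (affCard≡count-comb S′) (affCard≡count-comb S′) ⟨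
    affCard n S′ + affCard n S′
      ∎
    where
    open ≡-Reasoning
    S′ = s ∷ S
    disjoint : ∀ v → ¬ (Comb S′ true v × Comb S′ false (x ⊕ v))
    disjoint v (c , c′) = ∉aff (subst (Comb S′ true) v⊕[x⊕v]≡x (comb-⊕ c c′))
      where
      v⊕[x⊕v]≡x : v ⊕ (x ⊕ v) ≡ x
      v⊕[x⊕v]≡x = trans (⊕-leftComm v x v) (trans (cong (x ⊕_) (⊕-self v)) (⊕-identityʳ x))
    even⇔odd : ∀ v → Comb S′ false v ⇔ Comb S′ true (s ⊕ v)
    even⇔odd v = mk⇔
      (λ c → subst (Comb S′ true) (⊕-comm v s) (comb-⊕ c (comb-head s S)))
      (λ c → subst (Comb S′ false) (trans (⊕-comm (s ⊕ v) s) (⊕-cancelˡ s v))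
                   (comb-⊕ c (comb-head s S)))
    odd≡even : count (λ v → comb? S′ false (x ⊕ v)) (allVecs n) ≡ count (comb? S′ true) (allVecs n)
    odd≡even = begin
      count (λ v → comb? S′ false (x ⊕ v)) (allVecs n)
        ≡⟨ count-comb-translate S′ false x ⟩
      count (comb? S′ false) (allVecs n)
        ≡⟨ count-cong (comb? S′ false) (λ v → comb? S′ true (s ⊕ v)) even⇔odd (allVecs n) ⟩
      count (λ v → comb? S′ true (s ⊕ v)) (allVecs n)
        ≡⟨ count-comb-translate S′ true s ⟩
      count (comb? S′ true) (allVecs n) ∎

  nullity : List (V n) → ℕ
  nullity []      = 0
  nullity (x ∷ S) = 𝟙 (comb? S true x) + nullity S

  affCard*2^nullity : (s : V n) (S : List (V n)) → affCard n (s ∷ S) * 2 ^ nullity (s ∷ S) ≡ 2 ^ length S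
  affCard*2^nullity s [] rewrite 𝟙-no (comb? [] true s) comb-[] | affCard-[x] s = refl
  affCard*2^nullity s (s′ ∷ S) with comb? (s′ ∷ S) true s
  ... | yes c = begin
    affCard n (s ∷ s′ ∷ S) * (2 * 2 ^ N)
      ≡⟨ cong (_* (2 * 2 ^ N)) (affCard-∷-∈aff s (s′ ∷ S) c) ⟩
    affCard n (s′ ∷ S) * (2 * 2 ^ N)
      ≡⟨ *-leftComm (affCard n (s′ ∷ S)) 2 (2 ^ N) ⟩
    2 * (affCard n (s′ ∷ S) * 2 ^ N)
      ≡⟨ cong (2 *_) (affCard*2^nullity s′ S) ⟩
    2 * 2 ^ length S ∎
    where
    open ≡-Reasoning
    N = nullity (s′ ∷ S)
  ... | no ∉aff = begin
    affCard n (s ∷ s′ ∷ S) * 2 ^ N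
      ≡⟨ cong (_* 2 ^ N) (affCard-∷-∉aff s s′ S ∉aff) ⟩
    (affCard n (s′ ∷ S) + affCard n (s′ ∷ S)) * 2 ^ N
      ≡⟨ ℕP.*-distribʳ-+ (2 ^ N) (affCard n (s′ ∷ S)) _ ⟩
    affCard n (s′ ∷ S) * 2 ^ N + affCard n (s′ ∷ S) * 2 ^ N
      ≡⟨ cong₂ _+_ (affCard*2^nullity s′ S) (affCard*2^nullity s′ S) ⟩
    2 ^ length S + 2 ^ length S
      ≡⟨ cong (2 ^ length S +_) (ℕP.+-identityʳ _) ⟨
    2 * 2 ^ length S ∎
    where
    open ≡-Reasoning
    N = nullity (s′ ∷ S)

  hasDim⇔nullity : ∀ j r (S : List (V n)) → length S ≡ suc (j + r) → HasDim n r S ⇔ (nullity S ≡ j)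
  hasDim⇔nullity j r (s ∷ S) len = mk⇔ hasDim⇒ ⇒hasDim
    where
    N = nullity (s ∷ S)
    a = affCard n (s ∷ S)
    a*2^N≡ : a * 2 ^ N ≡ 2 ^ r * 2 ^ j
    a*2^N≡ = trans (affCard*2^nullity s S)
                   (trans (cong (2 ^_) (trans (ℕP.suc-injective len) (ℕP.+-comm j r)))
                          (ℕP.^-distribˡ-+-* 2 r j))
    hasDim⇒ : a ≡ 2 ^ r → N ≡ j
    hasDim⇒ a≡ = 2^-injective N j (ℕP.*-cancelˡ-≡ (2 ^ N) (2 ^ j) (2 ^ r) {{ℕP.m^n≢0 2 r}}
                                     (trans (cong (_* 2 ^ N) (sym a≡)) a*2^N≡))
    ⇒hasDim : N ≡ j → a ≡ 2 ^ r
    ⇒hasDim refl = ℕP.*-cancelʳ-≡ a (2 ^ r) (2 ^ N) {{ℕP.m^n≢0 2 N}} a*2^N≡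

-- Affine dependencies

module _ {n : ℕ} where

  AffDep : {S : List (V n)} → Mask S → Set
  AffDep d = Represents d false (𝟎 n)

  same-rep⇒affDep : {S : List (V n)} (m m′ : Mask S) {b : Bool} {v : V n} →
    Represents m b v → Represents m′ b v → AffDep (m ⊕ₘ m′)
  same-rep⇒affDep m m′ {b} {v} rep rep′ with represents-⊕ₘ m m′ rep rep′
  ... | par , sum = trans par (xor-same b) , trans sum (⊕-self v)

  affDep-insert-false⇔ : {z : V n} {T S : List (V n)} (p : Pick z T S) (m : Mask T) →
    AffDep (insert p false m) ⇔ AffDep m
  affDep-insert-false⇔ p m = mk⇔
    (λ (par , sum) → trans (cong parity (sym (weight-insert-false p m))) par
                   , trans (sym (Σsel-insert-false p m)) sum)
    (λ (par , sum) → trans (cong parity (weight-insert-false p m)) par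
                   , trans (Σsel-insert-false p m) sum)

  affDep-insert-true⇔ : {z : V n} {T S : List (V n)} (p : Pick z T S) (m : Mask T) →
    AffDep (insert p true m) ⇔ Represents m true z
  affDep-insert-true⇔ {z} p m = mk⇔
    (λ (par , sum) → not-injective (trans (cong parity (sym (weight-insert-true p m))) par)
                   , sym (⊕≡𝟎⇒≡ (trans (sym (Σsel-insert-true p m)) sum)))
    (λ (par , sum) → trans (cong parity (weight-insert-true p m)) (cong not par)
                   , trans (Σsel-insert-true p m) (trans (cong (z ⊕_) sum) (⊕-self z)))

  nullity≡0⇒dep-trivial : (S : List (V n)) → nullity S ≡ 0 → (d : Mask S) → AffDep d → weight d ≡ 0
  nullity≡0⇒dep-trivial []      _   []ₘ _ = refl
  nullity≡0⇒dep-trivial (x ∷ S) N≡0 d dep with comb? S true x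
  nullity≡0⇒dep-trivial (x ∷ S) ()  d            dep | yes _
  nullity≡0⇒dep-trivial (x ∷ S) N≡0 (false ∷ₘ d) dep | no _    =
    nullity≡0⇒dep-trivial S N≡0 d dep
  nullity≡0⇒dep-trivial (x ∷ S) N≡0 (true ∷ₘ d)  dep | no ∉aff =
    ⊥-elim (∉aff (d , to (affDep-insert-true⇔ pick-head d) dep))

  indep⇒rep-unique : {S : List (V n)} → nullity S ≡ 0 → {m m′ : Mask S} {b : Bool} {v : V n} →
    Represents m b v → Represents m′ b v → m ≡ m′
  indep⇒rep-unique {S} N≡0 {m} {m′} rep rep′ =
    weight-⊕ₘ≡0⇒≡ m m′ (nullity≡0⇒dep-trivial S N≡0 (m ⊕ₘ m′) (same-rep⇒affDep m m′ rep rep′))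

  nullity≢0⇒nontrivial-dep : (S : List (V n)) → nullity S ≢ 0 →
                             Σ[ d ∈ Mask S ] AffDep d × weight d ≢ 0
  nullity≢0⇒nontrivial-dep []      N≢0 = ⊥-elim (N≢0 refl)
  nullity≢0⇒nontrivial-dep (x ∷ S) N≢0 with comb? S true x
  ... | yes (m , rep) = true ∷ₘ m , from (affDep-insert-true⇔ pick-head m) rep , λ ()
  ... | no _ with nullity≢0⇒nontrivial-dep S N≢0
  ...   | d , dep , nz = false ∷ₘ d , dep , nz

  nontrivial-dep-head : {x : V n} {S : List (V n)} → nullity S ≡ 0 →
    (d : Mask (x ∷ S)) → AffDep d → weight d ≢ 0 → ∃ λ m → d ≡ true ∷ₘ m × Represents m true x
  nontrivial-dep-head {S = S} N≡0 (false ∷ₘ m) dep nz = ⊥-elim (nz (nullity≡0⇒dep-trivial S N≡0 m dep))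
  nontrivial-dep-head         _   (true ∷ₘ m)  dep _  = m , refl , to (affDep-insert-true⇔ pick-head m) dep

  dep-head-unselected : {x : V n} {S : List (V n)} → ¬ Comb S true x → (d : Mask (x ∷ S)) → AffDep d →
    ∃ λ m → d ≡ false ∷ₘ m × AffDep m
  dep-head-unselected ∉aff (false ∷ₘ m) dep = m , refl , dep
  dep-head-unselected ∉aff (true ∷ₘ m)  dep = ⊥-elim (∉aff (m , to (affDep-insert-true⇔ pick-head m) dep))

  nullity≡1⇒dep-unique : (S : List (V n)) → nullity S ≡ 1 → (d d′ : Mask S) →
    AffDep d → AffDep d′ → weight d ≢ 0 → weight d′ ≢ 0 → d ≡ d′
  nullity≡1⇒dep-unique (x ∷ S) N≡1 d d′ dep dep′ nz nz′ with comb? S true x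
  ... | yes _ with nontrivial-dep-head (ℕP.suc-injective N≡1) d dep nz
                 | nontrivial-dep-head (ℕP.suc-injective N≡1) d′ dep′ nz′
  ...   | m , refl , rep | m′ , refl , rep′ =
    cong (true ∷ₘ_) (indep⇒rep-unique (ℕP.suc-injective N≡1) rep rep′)
  nullity≡1⇒dep-unique (x ∷ S) N≡1 d d′ dep dep′ nz nz′ | no ∉aff
    with dep-head-unselected ∉aff d dep | dep-head-unselected ∉aff d′ dep′
  ... | m , refl , dm | m′ , refl , dm′ =
    cong (false ∷ₘ_) (nullity≡1⇒dep-unique S N≡1 m m′ dm dm′ nz nz′)

  unique-dep⇒nullity≤1 : (S : List (V n)) (δ : Mask S) →
                         (∀ d → AffDep d → weight d ≢ 0 → d ≡ δ) → nullity S ≤ 1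
  unique-dep⇒nullity≤1 []      _        _      = z≤n
  unique-dep⇒nullity≤1 (x ∷ S) (b ∷ₘ δ) unique with comb? S true x
  ... | no ∉aff = unique-dep⇒nullity≤1 S δ λ d dep nz → ∷ₘ-injectiveʳ (unique (false ∷ₘ d) dep nz)
  ... | yes (m , rep) with nullity S ℕ.≟ 0
  ...   | yes N≡0 = s≤s (ℕP.≤-reflexive N≡0)
  ...   | no N≢0 with nullity≢0⇒nontrivial-dep S N≢0
  ...     | d , dep , nz with () ←
    trans (unique (false ∷ₘ d) dep nz) (sym (unique (true ∷ₘ m) (from (affDep-insert-true⇔ pick-head m) rep) λ ()))

  record UniqueDep (S : List (V n)) : Set where
    field
      δ            : Mask S
      δ-dep        : AffDep δ
      δ-nontrivial : weight δ ≢ 0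
      δ-unique     : ∀ d → AffDep d → weight d ≢ 0 → d ≡ δ

  nullity≡1⇒UniqueDep : (S : List (V n)) → nullity S ≡ 1 → UniqueDep S
  nullity≡1⇒UniqueDep S N≡1 with nullity≢0⇒nontrivial-dep S (λ N≡0 → case trans (sym N≡1) N≡0 of λ ())
  ... | δ , dep , nz = record
    { δ = δ ; δ-dep = dep ; δ-nontrivial = nz
    ; δ-unique = λ d dep′ nz′ → nullity≡1⇒dep-unique S N≡1 d δ dep′ dep nz′ nz }

  UniqueDep⇒nullity≡1 : (S : List (V n)) → UniqueDep S → nullity S ≡ 1
  UniqueDep⇒nullity≡1 S U = ℕP.≤-antisym (unique-dep⇒nullity≤1 S δ δ-unique)
    (ℕP.n≢0⇒n>0 λ N≡0 → δ-nontrivial (nullity≡0⇒dep-trivial S N≡0 δ δ-dep))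
    where open UniqueDep U

  pick-indep⇒dep-unique : {z : V n} {T S : List (V n)} (p : Pick z T S) → nullity T ≡ 0 →
    {m₀ : Mask T} → Represents m₀ true z → ∀ d → AffDep d → weight d ≢ 0 → d ≡ insert p true m₀
  pick-indep⇒dep-unique {T = T} p N≡0 rep₀ d dep nz with insert-view p d
  ... | m , d≡ with at p d | d≡
  ...   | false | refl =
    ⊥-elim (nz (trans (weight-insert-false p m) (nullity≡0⇒dep-trivial T N≡0 m (to (affDep-insert-false⇔ p m) dep))))
  ...   | true  | refl = cong (insert p true) (indep⇒rep-unique N≡0 (to (affDep-insert-true⇔ p m) dep) rep₀)

  pick-indep⇒UniqueDep : {z : V n} {T S : List (V n)} (p : Pick z T S) → nullity T ≡ 0 →
    {m₀ : Mask T} → Represents m₀ true z → UniqueDep S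
  pick-indep⇒UniqueDep p N≡0 {m₀} rep₀ = record
    { δ            = insert p true m₀
    ; δ-dep        = from (affDep-insert-true⇔ p m₀) rep₀
    ; δ-nontrivial = λ w≡0 → case trans (sym (weight-insert-true p m₀)) w≡0 of λ ()
    ; δ-unique     = pick-indep⇒dep-unique p N≡0 rep₀ }

module _ {n : ℕ} where

  IsCap⇔no-quad : (S : List (V n)) → IsCap n S ⇔ (∀ (d : Mask S) → weight d ≡ 4 → Σsel d ≢ 𝟎 n)
  IsCap⇔no-quad S = mk⇔
    (λ cap d w≡4 Σ≡𝟎 → All.lookup cap (select∈combs 4 d w≡4) Σ≡𝟎)
    (λ no-quad → All.tabulate λ q∈ Σ≡𝟎 → let (d , w≡4 , q≡) = ∈combs⇒select 4 q∈ in
                                         no-quad d w≡4 (trans (cong (sumV n) (sym q≡)) Σ≡𝟎))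

  UniqueDep⇒cap : {S : List (V n)} (U : UniqueDep S) → weight (UniqueDep.δ U) ≢ 4 → IsCap n S
  UniqueDep⇒cap {S} U w≢4 = from (IsCap⇔no-quad S) λ d w≡4 Σ≡𝟎 →
    let d≡δ = δ-unique d (cong parity w≡4 , Σ≡𝟎) (λ w≡0 → case trans (sym w≡4) w≡0 of λ ())
    in w≢4 (trans (cong weight (sym d≡δ)) w≡4)
    where open UniqueDep U

  indep⇒cap : (S : List (V n)) → nullity S ≡ 0 → IsCap n S
  indep⇒cap S N≡0 = from (IsCap⇔no-quad S) λ d w≡4 Σ≡𝟎 →
    case trans (sym w≡4) (nullity≡0⇒dep-trivial S N≡0 d (cong parity w≡4 , Σ≡𝟎)) of λ ()

  weight≡1⇒Σsel∈ : {S : List (V n)} (m : Mask S) → weight m ≡ 1 → Σsel m ∈ S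
  weight≡1⇒Σsel∈ {x ∷ S} (true ∷ₘ m)  w≡1 =
    here (trans (cong (λ m → x ⊕ Σsel m) (weight≡0⇒∅ₘ m (ℕP.suc-injective w≡1)))
                (trans (cong (x ⊕_) (Σsel-∅ₘ S)) (⊕-identityʳ x)))
  weight≡1⇒Σsel∈         (false ∷ₘ m) w≡1 = there (weight≡1⇒Σsel∈ m w≡1)

  unique⇒no-pair-dep : {S : List (V n)} → Unique S → (d : Mask S) → weight d ≡ 2 → Σsel d ≢ 𝟎 n
  unique⇒no-pair-dep {x ∷ S} (x∉S ∷ _)    (true ∷ₘ m)  w≡2 Σ≡𝟎 =
    All.lookup x∉S (weight≡1⇒Σsel∈ m (ℕP.suc-injective w≡2)) (⊕≡𝟎⇒≡ Σ≡𝟎)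
  unique⇒no-pair-dep         (_ ∷ uniq) (false ∷ₘ m) w≡2 Σ≡𝟎 =
    unique⇒no-pair-dep uniq m w≡2 Σ≡𝟎

-- Sums of an odd number of independent points

module _ {n : ℕ} where

  Witness : ℕ → List (V n) → V n → Set
  Witness i T z = nullity T ≡ 0 × Σ[ m ∈ Mask T ] weight m ≡ 1 + 2 * i × Σsel m ≡ z

  witness? : (i : ℕ) (T : List (V n)) (z : V n) → Dec (Witness i T z)
  witness? i T z =
    (nullity T ℕ.≟ 0) ×-dec ∃-mask? T (λ m → (weight m ℕ.≟ 1 + 2 * i) ×-dec (Σsel m ≟V z))

  witness⇔ : (i : ℕ) {z : V n} {T S : List (V n)} (U : UniqueDep S) (p : Pick z T S) →
    Witness i T z ⇔ (at p (UniqueDep.δ U) ≡ true × weight (UniqueDep.δ U) ≡ 2 + 2 * i)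
  witness⇔ i {z} {T} {S} U p = mk⇔ witness⇒ ⇒witness
    where
    open UniqueDep U
    witness⇒ : Witness i T z → at p δ ≡ true × weight δ ≡ 2 + 2 * i
    witness⇒ (N≡0 , m₀ , w≡ , Σ≡)
      rewrite pick-indep⇒dep-unique p N≡0 (parity-odd i w≡ , Σ≡) δ δ-dep δ-nontrivial =
      at-insert p true m₀ , trans (weight-insert-true p m₀) (cong suc w≡)
    ⇒witness : at p δ ≡ true × weight δ ≡ 2 + 2 * i → Witness i T z
    ⇒witness (at≡true , w≡) with insert-view p δ
    ... | m , δ≡ rewrite at≡true =
      T-indep , m , w[m]≡ , proj₂ (to (affDep-insert-true⇔ p m) (subst AffDep δ≡ δ-dep))
      where
      w[m]≡ : weight m ≡ 1 + 2 * i
      w[m]≡ = ℕP.suc-injective (trans (sym (weight-insert-true p m)) (trans (cong weight (sym δ≡)) w≡))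
      T-indep : nullity T ≡ 0
      T-indep with nullity T ℕ.≟ 0
      ... | yes N≡0 = N≡0
      ... | no N≢0 with nullity≢0⇒nontrivial-dep T N≢0
      ...   | e , dep , nz = ⊥-elim (avoids-z (δ-unique (insert p false e) dep′ nz′))
        where
        dep′ = from (affDep-insert-false⇔ p e) dep
        nz′  = nz ∘ trans (sym (weight-insert-false p e))
        avoids-z : insert p false e ≢ δ
        avoids-z e≡δ = case trans (sym (at-insert p false e)) (trans (cong (at p) e≡δ) at≡true) of λ ()

  witness-∉ : {i : ℕ} {T : List (V n)} {y : V n} → 1 ≤ i → y ∈ T → ¬ Witness i T y
  witness-∉ {i} 1≤i y∈T (N≡0 , m , w≡ , Σ≡) with ∈⇒weight≡1 y∈T
  ... | m₁ , w₁≡1 , Σ₁≡ with indep⇒rep-unique N≡0 {m} {m₁} (parity-odd i w≡ , Σ≡) (parity-odd 0 w₁≡1 , Σ₁≡)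
  ...   | refl with () ← ℕP.≤-trans (ℕP.*-monoʳ-≤ 2 1≤i) (ℕP.≤-reflexive (ℕP.suc-injective (trans (sym w≡) w₁≡1)))

  witnessCount : ℕ → List (V n) → ℕ
  witnessCount i = picksSum (λ T z → 𝟙 (witness? i T z))

  witnessCount-UniqueDep : (i : ℕ) {S : List (V n)} (U : UniqueDep S) →
    witnessCount i S ≡ 𝟙 (weight (UniqueDep.δ U) ℕ.≟ 2 + 2 * i) * (2 + 2 * i)
  witnessCount-UniqueDep i {S} U with weight (UniqueDep.δ U) ℕ.≟ 2 + 2 * i
  ... | no w≢ = ∑-zero (picks S) λ {q} _ → let (z , T , p) = q in
                  𝟙-no (witness? i T z) (w≢ ∘ proj₂ ∘ to (witness⇔ i U p))
  ... | yes w≡ = begin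
    witnessCount i S
      ≡⟨ ∑-cong (picks S) (λ {q} _ → let (z , T , p) = q in
           𝟙-cong (witness? i T z) (at p δ Bool.≟ true)
                  (mk⇔ (proj₁ ∘ to (witness⇔ i U p)) (λ a → from (witness⇔ i U p) (a , w≡)))) ⟩
    ∑[ (_ , _ , p) ∈ picks S ] 𝟙 (at p δ Bool.≟ true)
      ≡⟨ ∑-picks-at δ ⟩
    weight δ
      ≡⟨ trans w≡ (sym (ℕP.+-identityʳ _)) ⟩
    1 * (2 + 2 * i) ∎
    where
    open ≡-Reasoning
    open UniqueDep U

  ∑-witness : (i : ℕ) (T : List (V n)) →
    ∑[ y ∈ allVecs n ] 𝟙 (witness? i T y) ≡ 𝟙 (nullity T ℕ.≟ 0) * (length T C (1 + 2 * i))
  ∑-witness i T = by-independence (nullity T ℕ.≟ 0)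
    where
    open ≡-Reasoning
    Q? : (y : V n) (m : Mask T) → Dec (weight m ≡ 1 + 2 * i × Σsel m ≡ y)
    Q? y m = (weight m ℕ.≟ 1 + 2 * i) ×-dec (Σsel m ≟V y)
    by-independence : (indep? : Dec (nullity T ≡ 0)) →
      ∑[ y ∈ allVecs n ] 𝟙 (witness? i T y) ≡ 𝟙 indep? * (length T C (1 + 2 * i))
    by-independence (no N≢0)  = ∑-zero (allVecs n) (λ {y} _ → 𝟙-no (witness? i T y) (N≢0 ∘ proj₁))
    by-independence (yes N≡0) = begin
      ∑[ y ∈ allVecs n ] 𝟙 (witness? i T y)
        ≡⟨ ∑-cong (allVecs n) (λ {y} _ →
             𝟙-cong (witness? i T y) (∃-mask? T (Q? y)) (mk⇔ proj₂ (N≡0 ,_))) ⟩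
      ∑[ y ∈ allVecs n ] 𝟙 (∃-mask? T (Q? y))
        ≡⟨ ∑-cong (allVecs n) (λ {y} _ → 𝟙-∃-mask≡count T (Q? y) λ (w≡ , Σ≡) (w≡′ , Σ≡′) →
             indep⇒rep-unique N≡0 (parity-odd i w≡ , Σ≡) (parity-odd i w≡′ , Σ≡′)) ⟩
      ∑[ y ∈ allVecs n ] ∑[ m ∈ masks T ] 𝟙 (Q? y m)
        ≡⟨ ∑-comm (allVecs n) (masks T) (λ y m → 𝟙 (Q? y m)) ⟩
      ∑[ m ∈ masks T ] ∑[ y ∈ allVecs n ] 𝟙 (Q? y m)
        ≡⟨ ∑-cong (masks T) (λ {m} _ → count-fibre (weight m ℕ.≟ 1 + 2 * i) (Σsel m)) ⟩
      count (λ m → weight m ℕ.≟ 1 + 2 * i) (masks T)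
        ≡⟨ count-masks-weight T (1 + 2 * i) ⟩
      length T C (1 + 2 * i)
        ≡⟨ ℕP.+-identityʳ _ ⟨
      1 * (length T C (1 + 2 * i)) ∎

-- Caps of codimension one

∈-range2 : ∀ {i h} → 2 ≤ i → i ≤ h → i ∈ range2 h
∈-range2 {suc (suc j)} (s≤s (s≤s z≤n)) i≤h =
  ∈-map⁺ (λ j → 2 + j) (∈-upTo⁺ (ℕP.∸-monoˡ-≤ 1 i≤h))

range2-≥2 : ∀ {i h} → i ∈ range2 h → 2 ≤ i
range2-≥2 i∈ with ∈-map⁻ (λ j → 2 + j) i∈
... | _ , _ , refl = s≤s (s≤s z≤n)

count-range2-≡ : ∀ {i h} → 2 ≤ i → i ≤ h → count (ℕ._≟ i) (range2 h) ≡ 1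
count-range2-≡ {h = h} 2≤i i≤h =
  count-≡ ℕ._≟_ (map⁺ (ℕP.+-cancelˡ-≡ 2 _ _) (upTo⁺ (h ∸ 1))) (∈-range2 2≤i i≤h)

module _ {n : ℕ} where

  CapDim : ℕ → List (V n) → Set
  CapDim r S = IsCap n S × HasDim n r S

  -- Literally the predicate filtered in Q.
  capDim? : (r : ℕ) (S : List (V n)) → Dec (CapDim r S)
  capDim? r S = isCap? n S ×-dec (affCard n S ℕ.≟ 2 ^ r)

  HasDepOfWeight : ℕ → List (V n) → Set
  HasDepOfWeight w S = Σ[ d ∈ Mask S ] AffDep d × weight d ≡ w

  hasDepOfWeight? : (w : ℕ) (S : List (V n)) → Dec (HasDepOfWeight w S)
  hasDepOfWeight? w S =
    ∃-mask? S (λ d → ((parity (weight d) Bool.≟ false) ×-dec (Σsel d ≟V 𝟎 n)) ×-dec (weight d ℕ.≟ w))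

  hasDepOfWeight⇔ : {S : List (V n)} (U : UniqueDep S) (w : ℕ) →
    HasDepOfWeight (suc w) S ⇔ (weight (UniqueDep.δ U) ≡ suc w)
  hasDepOfWeight⇔ U w = mk⇔
    (λ (d , dep , w≡) → trans (cong weight (sym (δ-unique d dep λ w≡0 → case trans (sym w≡) w≡0 of λ ()))) w≡)
    (λ w≡ → δ , δ-dep , w≡)
    where open UniqueDep U

  capDim⇔indep : (r : ℕ) (T : List (V n)) → length T ≡ suc r → CapDim r T ⇔ (nullity T ≡ 0)
  capDim⇔indep r T len = mk⇔ (to (hasDim⇔nullity 0 r T len) ∘ proj₂)
                           (λ N≡0 → indep⇒cap T N≡0 , from (hasDim⇔nullity 0 r T len) N≡0)

  capDim⇒UniqueDep : (r : ℕ) (S : List (V n)) → length S ≡ 2 + r → CapDim r S → UniqueDep S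
  capDim⇒UniqueDep r S len (_ , dim) = nullity≡1⇒UniqueDep S (to (hasDim⇔nullity 1 r S len) dim)

  witness⇒capDim : (r : ℕ) {i : ℕ} {z : V n} {T : List (V n)} (S : List (V n)) →
    2 ≤ i → length S ≡ 2 + r → Pick z T S → Witness i T z → CapDim r S
  witness⇒capDim r {i} S 2≤i len p (N≡0 , m₀ , w≡ , Σ≡) =
    UniqueDep⇒cap U w≢4 , from (hasDim⇔nullity 1 r S len) (UniqueDep⇒nullity≡1 S U)
    where
    U = pick-indep⇒UniqueDep p N≡0 (parity-odd i w≡ , Σ≡)
    6≤w : 6 ≤ weight (insert p true m₀)
    6≤w = ℕP.≤-trans (ℕP.+-monoʳ-≤ 2 (ℕP.*-monoʳ-≤ 2 2≤i))
                     (ℕP.≤-reflexive (sym (trans (weight-insert-true p m₀) (cong suc w≡))))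
    w≢4 : weight (insert p true m₀) ≢ 4
    w≢4 w≡4 = ℕP.<⇒≢ (ℕP.≤-trans (ℕP.n≤1+n 5) 6≤w) (sym w≡4)

  cap-dep-weight : {S : List (V n)} → Unique S → IsCap n S → (U : UniqueDep S) →
    ∃ λ i₀ → 2 ≤ i₀ × weight (UniqueDep.δ U) ≡ 2 + 2 * i₀
  cap-dep-weight {S} uniq cap U = from-even (parity≡false⇒even (weight δ) (proj₁ δ-dep))
    where
    open UniqueDep U
    from-even : (∃ λ j → weight δ ≡ 2 * j) → ∃ λ i₀ → 2 ≤ i₀ × weight δ ≡ 2 + 2 * i₀
    from-even (0 , w≡0) = ⊥-elim (δ-nontrivial w≡0)
    from-even (1 , w≡2) = ⊥-elim (unique⇒no-pair-dep uniq δ w≡2 (proj₂ δ-dep))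
    from-even (2 , w≡4) = ⊥-elim (to (IsCap⇔no-quad S) cap δ w≡4 (proj₂ δ-dep))
    from-even (suc (suc (suc j)) , w≡) = suc (suc j) , s≤s (s≤s z≤n) , trans w≡ (ℕP.*-suc 2 (2 + j))

  witnessCount-capDim : (r i : ℕ) (S : List (V n)) → 2 ≤ i → length S ≡ 2 + r →
    witnessCount i S ≡ 𝟙 (capDim? r S ×-dec hasDepOfWeight? (2 + 2 * i) S) * (2 + 2 * i)
  witnessCount-capDim r i S 2≤i len = by-capDim (capDim? r S)
    where
    by-capDim : (cd? : Dec (CapDim r S)) →
      witnessCount i S ≡ 𝟙 (cd? ×-dec hasDepOfWeight? (2 + 2 * i) S) * (2 + 2 * i)
    by-capDim (no ¬cd) = ∑-zero (picks S) λ {q} _ → let (z , T , p) = q in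
                           𝟙-no (witness? i T z) (¬cd ∘ witness⇒capDim r S 2≤i len p)
    by-capDim (yes cd) = trans (witnessCount-UniqueDep i U) (cong (_* (2 + 2 * i))
      (𝟙-cong (weight (UniqueDep.δ U) ℕ.≟ 2 + 2 * i) (yes cd ×-dec hasDepOfWeight? (2 + 2 * i) S)
              (mk⇔ (λ w≡ → cd , from (hasDepOfWeight⇔ U _) w≡) (to (hasDepOfWeight⇔ U _) ∘ proj₂))))
      where U = capDim⇒UniqueDep r S len cd

  𝟙-capDim≡∑ : (r : ℕ) (S : List (V n)) → Unique S → length S ≡ 2 + r →
    𝟙 (capDim? r S) ≡ ∑[ i ∈ range2 (r / 2) ] 𝟙 (capDim? r S ×-dec hasDepOfWeight? (2 + 2 * i) S)
  𝟙-capDim≡∑ r S uniq len = by-capDim (capDim? r S)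
    where
    by-capDim : (cd? : Dec (CapDim r S)) →
      𝟙 cd? ≡ ∑[ i ∈ range2 (r / 2) ] 𝟙 (cd? ×-dec hasDepOfWeight? (2 + 2 * i) S)
    by-capDim (no ¬cd) = sym (∑-zero (range2 (r / 2)) (λ _ → refl))
    by-capDim (yes cd) = begin
      1                                          ≡⟨ count-range2-≡ 2≤i₀ i₀≤r/2 ⟨
      ∑[ i ∈ range2 (r / 2) ] 𝟙 (i ℕ.≟ i₀)
        ≡⟨ ∑-cong (range2 (r / 2)) (λ {i} _ →
             𝟙-cong (i ℕ.≟ i₀) (yes cd ×-dec hasDepOfWeight? (2 + 2 * i) S) (i≡i₀⇔ i)) ⟩
      ∑[ i ∈ range2 (r / 2) ] 𝟙 (yes cd ×-dec hasDepOfWeight? (2 + 2 * i) S) ∎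
      where
      open ≡-Reasoning
      U = capDim⇒UniqueDep r S len cd
      open UniqueDep U
      i₀ = proj₁ (cap-dep-weight uniq (proj₁ cd) U)
      2≤i₀ = proj₁ (proj₂ (cap-dep-weight uniq (proj₁ cd) U))
      w≡ = proj₂ (proj₂ (cap-dep-weight uniq (proj₁ cd) U))
      i≡i₀⇔ : ∀ i → (i ≡ i₀) ⇔ (CapDim r S × HasDepOfWeight (2 + 2 * i) S)
      i≡i₀⇔ i = mk⇔ (λ { refl → cd , from (hasDepOfWeight⇔ U _) w≡ })
                    (λ (_ , has) → 2+2*-injective (trans (sym (to (hasDepOfWeight⇔ U _) has)) w≡))
      i₀≤r/2 : i₀ ≤ r / 2
      i₀≤r/2 = 2*m≤n⇒m≤n/2 (ℕP.+-cancelˡ-≤ 2 _ _ (subst₂ _≤_ w≡ len (weight≤length δ)))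

module _ where
  open import Data.Integer as ℤ using (+_)
  import Data.Integer.Properties as ℤP
  import Data.Rational as ℚ
  import Data.Rational.Properties as ℚP
  open import Data.Rational.Unnormalised as ℚᵘ using (ℚᵘ; mkℚᵘ; *≡*)
  import Data.Rational.Unnormalised.Properties as ℚᵘP

  fromℚᵘ-homo-+ : ∀ p q → ℚ.fromℚᵘ (p ℚᵘ.+ q) ≡ ℚ.fromℚᵘ p ℚ.+ ℚ.fromℚᵘ q
  fromℚᵘ-homo-+ p q = ℚP.toℚᵘ-injective (begin
    ℚ.toℚᵘ (ℚ.fromℚᵘ (p ℚᵘ.+ q))                  ≈⟨ ℚP.toℚᵘ-fromℚᵘ (p ℚᵘ.+ q) ⟩
    p ℚᵘ.+ q                                       ≈⟨ ℚᵘP.+-cong (ℚP.toℚᵘ-fromℚᵘ p) (ℚP.toℚᵘ-fromℚᵘ q) ⟨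
    ℚ.toℚᵘ (ℚ.fromℚᵘ p) ℚᵘ.+ ℚ.toℚᵘ (ℚ.fromℚᵘ q)  ≈⟨ ℚP.toℚᵘ-homo-+ (ℚ.fromℚᵘ p) (ℚ.fromℚᵘ q) ⟨
    ℚ.toℚᵘ (ℚ.fromℚᵘ p ℚ.+ ℚ.fromℚᵘ q)            ∎)
    where open ℚᵘP.≃-Reasoning

  fromℚᵘ-homo-* : ∀ p q → ℚ.fromℚᵘ (p ℚᵘ.* q) ≡ ℚ.fromℚᵘ p ℚ.* ℚ.fromℚᵘ q
  fromℚᵘ-homo-* p q = ℚP.toℚᵘ-injective (begin
    ℚ.toℚᵘ (ℚ.fromℚᵘ (p ℚᵘ.* q))                  ≈⟨ ℚP.toℚᵘ-fromℚᵘ (p ℚᵘ.* q) ⟩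
    p ℚᵘ.* q                                       ≈⟨ ℚᵘP.*-cong (ℚP.toℚᵘ-fromℚᵘ p) (ℚP.toℚᵘ-fromℚᵘ q) ⟨
    ℚ.toℚᵘ (ℚ.fromℚᵘ p) ℚᵘ.* ℚ.toℚᵘ (ℚ.fromℚᵘ q)  ≈⟨ ℚP.toℚᵘ-homo-* (ℚ.fromℚᵘ p) (ℚ.fromℚᵘ q) ⟨
    ℚ.toℚᵘ (ℚ.fromℚᵘ p ℚ.* ℚ.fromℚᵘ q)            ∎)
    where open ℚᵘP.≃-Reasoning

  fromℕℚ-+ : ∀ a b → fromℕℚ (a + b) ≡ fromℕℚ a ℚ.+ fromℕℚ b
  fromℕℚ-+ a b =
    trans (ℚP.fromℚᵘ-cong {mkℚᵘ (+ (a + b)) 0} {mkℚᵘ (+ a) 0 ℚᵘ.+ mkℚᵘ (+ b) 0} (*≡* ↥↧-eq))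
          (fromℚᵘ-homo-+ (mkℚᵘ (+ a) 0) (mkℚᵘ (+ b) 0))
    where
    ↥↧-eq : + (a + b) ℤ.* + 1 ≡ (+ a ℤ.* + 1 ℤ.+ + b ℤ.* + 1) ℤ.* + 1
    ↥↧-eq = begin
      + (a + b) ℤ.* + 1              ≡⟨ ℤP.*-identityʳ (+ (a + b)) ⟩
      + a ℤ.+ + b                    ≡⟨ cong₂ ℤ._+_ (ℤP.*-identityʳ (+ a)) (ℤP.*-identityʳ (+ b)) ⟨
      + a ℤ.* + 1 ℤ.+ + b ℤ.* + 1    ≡⟨ ℤP.*-identityʳ _ ⟨
      (+ a ℤ.* + 1 ℤ.+ + b ℤ.* + 1) ℤ.* + 1 ∎
      where open ≡-Reasoning

  fromℕℚ-/ : ∀ a b c j → suc j * a ≡ b * c → fromℕℚ a ≡ fromℕℚ b ℚ.* ((+ c) ℚ./ suc j)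
  fromℕℚ-/ a b c j eq =
    trans (ℚP.fromℚᵘ-cong {mkℚᵘ (+ a) 0} {mkℚᵘ (+ b) 0 ℚᵘ.* mkℚᵘ (+ c) j} (*≡* ↥↧-eq))
          (fromℚᵘ-homo-* (mkℚᵘ (+ b) 0) (mkℚᵘ (+ c) j))
    where
    ↥↧-eq : + a ℤ.* + (1 * suc j) ≡ (+ b ℤ.* + c) ℤ.* + 1
    ↥↧-eq = begin
      + a ℤ.* + (1 * suc j)   ≡⟨ ℤP.pos-* a (1 * suc j) ⟨
      + (a * (1 * suc j))     ≡⟨ cong +_ (trans (cong (a *_) (ℕP.*-identityˡ (suc j)))
                                                (trans (ℕP.*-comm a (suc j)) eq)) ⟩
      + (b * c)               ≡⟨ ℤP.pos-* b c ⟩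
      + b ℤ.* + c             ≡⟨ ℤP.*-identityʳ _ ⟨
      (+ b ℤ.* + c) ℤ.* + 1   ∎
      where open ≡-Reasoning

  fromℕℚ-∑ : (xs : List ℕ) (f : ℕ → ℕ) → fromℕℚ (∑ xs f) ≡ sumℚ (map (fromℕℚ ∘ f) xs)
  fromℕℚ-∑ []       f = refl
  fromℕℚ-∑ (x ∷ xs) f =
    trans (fromℕℚ-+ (f x) (∑ xs f)) (cong (fromℕℚ (f x) ℚ.+_) (fromℕℚ-∑ xs f))

  sumℚ-cong : (xs : List A) {f g : A → ℚ} → (∀ {x} → x ∈ xs → f x ≡ g x) →
              sumℚ (map f xs) ≡ sumℚ (map g xs)
  sumℚ-cong xs f≗g = cong sumℚ (map-cong-local (All.tabulate f≗g))

  sumℚ-*ˡ : (q : ℚ) (xs : List A) (f : A → ℚ) →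
            sumℚ (map (λ x → q ℚ.* f x) xs) ≡ q ℚ.* sumℚ (map f xs)
  sumℚ-*ˡ q []       f = sym (ℚP.*-zeroʳ q)
  sumℚ-*ˡ q (x ∷ xs) f =
    trans (cong (q ℚ.* f x ℚ.+_) (sumℚ-*ˡ q xs f)) (sym (ℚP.*-distribˡ-+ q (f x) _))

-- The double count

module DoubleCounting {n : ℕ} (r : ℕ) where

  X : List (V n)
  X = allVecs n

  Qₖ Qₖ₋₁ : ℕ
  Qₖ   = Q r (2 + r) n
  Qₖ₋₁ = Q r (1 + r) n

  capsWithDep : ℕ → ℕ
  capsWithDep i = count (λ S → capDim? r S ×-dec hasDepOfWeight? (2 + 2 * i) S) (combs (2 + r) X)

  Qₖ≡∑capsWithDep : Qₖ ≡ ∑ (range2 (r / 2)) capsWithDep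
  Qₖ≡∑capsWithDep = begin
    Qₖ
      ≡⟨ length-filter≡count (capDim? r) (combs (2 + r) X) ⟩
    ∑[ S ∈ combs (2 + r) X ] 𝟙 (capDim? r S)
      ≡⟨ ∑-cong (combs (2 + r) X) (λ {S} S∈ → 𝟙-capDim≡∑ r S (combs-unique (2 + r) {X} (allVecs-unique n) S∈)
                                                              (combs-length (2 + r) X S∈)) ⟩
    ∑[ S ∈ combs (2 + r) X ] ∑[ i ∈ range2 (r / 2) ] 𝟙 (capDim? r S ×-dec hasDepOfWeight? (2 + 2 * i) S)
      ≡⟨ ∑-comm (combs (2 + r) X) (range2 (r / 2)) _ ⟩
    ∑ (range2 (r / 2)) capsWithDep ∎
    where open ≡-Reasoning

  Qₖ₋₁≡count-indep : Qₖ₋₁ ≡ ∑[ T ∈ combs (1 + r) X ] 𝟙 (nullity T ℕ.≟ 0)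
  Qₖ₋₁≡count-indep = trans (length-filter≡count (capDim? r) (combs (1 + r) X))
    (∑-cong (combs (1 + r) X) λ {T} T∈ →
      𝟙-cong (capDim? r T) (nullity T ℕ.≟ 0) (capDim⇔indep r T (combs-length (1 + r) X T∈)))

  [2+2i]*capsWithDep≡Qₖ₋₁*C : ∀ i → 2 ≤ i → (2 + 2 * i) * capsWithDep i ≡ Qₖ₋₁ * ((1 + r) C (1 + 2 * i))
  [2+2i]*capsWithDep≡Qₖ₋₁*C i 2≤i = begin
    (2 + 2 * i) * capsWithDep i
      ≡⟨ ℕP.*-comm (2 + 2 * i) (capsWithDep i) ⟩
    capsWithDep i * (2 + 2 * i)
      ≡⟨ ∑-*ʳ (2 + 2 * i) (combs (2 + r) X) _ ⟨
    ∑[ S ∈ combs (2 + r) X ] (𝟙 (capDim? r S ×-dec hasDepOfWeight? (2 + 2 * i) S) * (2 + 2 * i))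
      ≡⟨ ∑-cong (combs (2 + r) X) (λ {S} S∈ → witnessCount-capDim r i S 2≤i (combs-length (2 + r) X S∈)) ⟨
    ∑[ S ∈ combs (2 + r) X ] witnessCount i S
      ≡⟨ ∑-combs-picks X (1 + r) (λ T y → 𝟙 (witness? i T y)) (λ y∈T → 𝟙-no _ (witness-∉ 1≤i y∈T)) ⟩
    ∑[ T ∈ combs (1 + r) X ] ∑[ y ∈ X ] 𝟙 (witness? i T y)
      ≡⟨ ∑-cong (combs (1 + r) X) (λ {T} T∈ → trans (∑-witness i T)
           (cong (λ l → 𝟙 (nullity T ℕ.≟ 0) * (l C (1 + 2 * i))) (combs-length (1 + r) X T∈))) ⟩
    ∑[ T ∈ combs (1 + r) X ] (𝟙 (nullity T ℕ.≟ 0) * ((1 + r) C (1 + 2 * i)))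
      ≡⟨ ∑-*ʳ ((1 + r) C (1 + 2 * i)) (combs (1 + r) X) _ ⟩
    ∑[ T ∈ combs (1 + r) X ] 𝟙 (nullity T ℕ.≟ 0) * ((1 + r) C (1 + 2 * i))
      ≡⟨ cong (_* ((1 + r) C (1 + 2 * i))) Qₖ₋₁≡count-indep ⟨
    Qₖ₋₁ * ((1 + r) C (1 + 2 * i)) ∎
    where
    open ≡-Reasoning
    1≤i = ℕP.≤-trans (ℕP.n≤1+n 1) 2≤i

  fromℕℚ-capsWithDep : ∀ {i} → i ∈ range2 (r / 2) → fromℕℚ (capsWithDep i) ≡ fromℕℚ Qₖ₋₁ *ℚ term (2 + r) i
  fromℕℚ-capsWithDep {i} i∈ = fromℕℚ-/ (capsWithDep i) Qₖ₋₁ ((1 + r) C (1 + 2 * i)) (1 + 2 * i)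
                                       ([2+2i]*capsWithDep≡Qₖ₋₁*C i (range2-≥2 {h = r / 2} i∈))

theorem7p5 : (k n : ℕ) → 6 ≤ k →
    fromℕℚ (Q (k Data.Nat.∸ 2) k n)
      ≡ fromℕℚ (Q (k Data.Nat.∸ 2) (k Data.Nat.∸ 1) n) *ℚ sumℚ (map (term k) (range2 (hOf k)))
-- The identity holds for every k ≥ 2.
theorem7p5 (suc (suc r)) n (s≤s (s≤s _)) = begin
  fromℕℚ Qₖ                                           ≡⟨ cong fromℕℚ Qₖ≡∑capsWithDep ⟩
  fromℕℚ (∑ I capsWithDep)                            ≡⟨ fromℕℚ-∑ I capsWithDep ⟩
  sumℚ (map (fromℕℚ ∘ capsWithDep) I)                 ≡⟨ sumℚ-cong I fromℕℚ-capsWithDep ⟩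
  sumℚ (map (λ i → fromℕℚ Qₖ₋₁ *ℚ term (2 + r) i) I)  ≡⟨ sumℚ-*ˡ (fromℕℚ Qₖ₋₁) I (term (2 + r)) ⟩
  fromℕℚ Qₖ₋₁ *ℚ sumℚ (map (term (2 + r)) I)          ∎
  where
  open ≡-Reasoning
  open DoubleCounting {n} r
  I = range2 (r / 2)
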